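{- Let $m\ge1$ and $k\ge1$ be integers. Then \[ \sum_{n\ge0}\Big(\sum_{\lambda\vdash n}\#\{i:\ \lambda_i\ge m,\ h_{i,m}(\lambda)=k\}\Big)q^n=\frac{q^{km}}{(q^k;q)_\infty}\sum_{l=1}^{k}\frac{q^{ -(l-1)(m-1)}(q^m;q)_{l-1}}{(q;q)_{l-1}(q;q)_{k-l}}, \] i.e. the right-hand side is the generating function for the number of $m$th column hooks of size $k$ in all partitions of $n$.
   Context: For a partition $\lambda=(\lambda_1\ge\lambda_2\ge\cdots)$ with conjugate $\lambda'$, the hook length of the cell $(i,j)$ (with $j\le\lambda_i$) is $h_{i,j}(\lambda)=\lambda_i+\lambda'_j-i-j+1$. Notation: $(a;b)_n=\prod_{t=0}^{n-1}(1-ab^t)$ and $(a;b)_\infty=\prod_{t=0}^{\infty}(1-ab^t)$. -}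

module Defs where

open import Data.Nat as ℕ using (ℕ; zero; suc; _≤_; _≤?_; _≟_)
open import Data.Integer as ℤ using (ℤ; +_; -_; _+_; _*_; _-_)
open import Data.List using (List; []; _∷_; length; filter; map; foldr; upTo; zipWith)
open import Data.Nat.ListAction using (sum)
open import Data.List.Relation.Unary.All using (All)
open import Data.List.Relation.Unary.Linked using (Linked)
open import Relation.Binary.PropositionalEquality using (_≡_)
open import Relation.Nullary.Decidable using (_×-dec_; does)
open import Data.Bool using (if_then_else_)
open import Data.Product using (_×_)

IsPartitionOf : ℕ → List ℕ → Set
IsPartitionOf n p = Linked ℕ._≥_ p × All (1 ≤_) p × sum p ≡ n

-- i-th part, 1-indexed (0 outside the range)
part : List ℕ → ℕ → ℕ
part []       _             = 0
part (x ∷ xs) zero          = 0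
part (x ∷ xs) (suc zero)    = x
part (x ∷ xs) (suc (suc i)) = part xs (suc i)

conj : List ℕ → ℕ → ℕ
conj p j = length (filter (λ x → j ≤? x) p)

-- hook length h_{i,j}(λ) = λ_i + λ'_j - i - j + 1 (meaningful for j ≤ λ_i,
-- where it is ≥ 1, so truncated subtraction is exact there)
hook : List ℕ → ℕ → ℕ → ℕ
hook p i j = (part p i ℕ.+ conj p j ℕ.+ 1) ℕ.∸ (i ℕ.+ j)

colHooks : ℕ → ℕ → List ℕ → ℕ
colHooks m k p =
  length (filter (λ i → (m ≤? part p i) ×-dec (hook p i m ≟ k))
                 (map suc (upTo (length p))))

Series : Set
Series = ℕ → ℤ

sumℤ : List ℤ → ℤ
sumℤ = foldr _+_ (+ 0)

_⊛_ : Series → Series → Series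
(f ⊛ g) n = sumℤ (map (λ i → f i * g (n ℕ.∸ i)) (upTo (suc n)))

one : Series
one n = if does (n ≟ 0) then + 1 else + 0

shift : ℕ → Series → Series
shift e f n = if does (e ≤? n) then f (n ℕ.∸ e) else + 0

oneMinusQ : ℕ → Series
oneMinusQ e n = one n - (if does (n ≟ e) then + 1 else + 0)

sumSeries : List Series → Series
sumSeries fs n = sumℤ (map (λ f → f n) fs)

prodSeries : List Series → Series
prodSeries = foldr _⊛_ one

pochFin : ℕ → ℕ → Series
pochFin a n = prodSeries (map (λ t → oneMinusQ (a ℕ.+ t)) (upTo n))

-- (q^a; q)_∞ for a ≥ 1, as a formal power series: its coefficient of q^n
-- equals that of the finite product (q^a;q)_{n+1}, since the remaining
-- factors 1 - q^{a+t} (t ≥ n+1) only affect degrees > n.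
pochInf : ℕ → Series
pochInf a n = pochFin a (suc n) n

-- Reciprocal of a formal power series with constant term 1:
-- g₀ = 1, g_n = - Σ_{i=1}^{n} f_i g_{n-i}.
-- invList f n = [g_n, g_{n-1}, …, g_0]
invList : Series → ℕ → List ℤ
invList f zero    = + 1 ∷ []
invList f (suc n) =
  let prev = invList f n in
  (- sumℤ (zipWith (λ i g → f i * g) (map suc (upTo (suc n))) prev)) ∷ prev

headℤ : List ℤ → ℤ
headℤ []      = + 0
headℤ (x ∷ _) = x

inv : Series → Series
inv f n = headℤ (invList f n)

-- Right-hand side:
--  q^{km}/(q^k;q)_∞ · Σ_{l=1}^{k} q^{-(l-1)(m-1)} (q^m;q)_{l-1} / ((q;q)_{l-1} (q;q)_{k-l})
-- The monomials q^{km} q^{-(l-1)(m-1)} are combined into q^{km-(l-1)(m-1)};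
-- km ≥ (l-1)(m-1) for 1 ≤ l ≤ k, so the truncated subtraction is exact.

rhsTerm : ℕ → ℕ → ℕ → Series
rhsTerm m k l =
  shift ((k ℕ.* m) ℕ.∸ ((l ℕ.∸ 1) ℕ.* (m ℕ.∸ 1)))
        (pochFin m (l ℕ.∸ 1) ⊛ (inv (pochFin 1 (l ℕ.∸ 1)) ⊛ inv (pochFin 1 (k ℕ.∸ l))))

rhs : ℕ → ℕ → Series
rhs m k = inv (pochInf k) ⊛ sumSeries (map (rhsTerm m k) (map suc (upTo k)))

-- Let H_M be the generating function, over partitions with parts ≤ M, of the number of
-- column-m hooks of size k. Splitting off a largest part M + 1 adds one new cell to column m,
-- whose hook has arm M + 1 - m and leg the number of parts ≥ m of the rest; hence
-- H_{M+1} (1 - q^{M+1}) = H_M + q^{M+1} X_M, with X_M the generating function of the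
-- partitions with parts ≤ M + 1 having exactly k - 1 - (M + 1 - m) parts ≥ m. As H vanishes
-- for M < m, telescoping gives H_{m-1+t} (q^m;q)_t = Σ_{a<t} q^{m+a} X_{m-1+a} (q^m;q)_a.
-- Partitions with parts ≤ a + m having exactly r parts ≥ m are counted by
-- q^{rm} [a+r choose r]_q / (q;q)_{m-1}, both sides obeying the q-Pascal recurrence; so the
-- a-th summand is the (a+1)-st term of the right-hand side times (q;q)_{k-1} / (q;q)_{m-1},
-- and it vanishes for a ≥ k. Hence H_N (q^k;q)_{N-k+1} is that finite sum once N ≥ m + k - 1;
-- for N = n + m + k - 1 the coefficient of q^n in H_N is the count in the theorem, and
-- (q^k;q)_{N-k+1} agrees with (q^k;q)_∞ up to degree n.

module Submission where

open import Defs
open import Data.Nat using (ℕ; _≤_; suc)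
open import Data.Integer using (ℤ; +_)
open import Data.List using (List; map)
open import Data.Nat.ListAction using (sum)
open import Data.List.Membership.Propositional using (_∈_)
open import Data.List.Relation.Unary.Unique.Propositional using (Unique)
open import Data.Product using (_×_; _,_)
open import Relation.Binary.PropositionalEquality using (_≡_)

open import Level using (0ℓ)
open import Relation.Binary.Bundles using (Setoid)
open import Relation.Binary.PropositionalEquality
  using (refl; sym; trans; cong; cong₂; cong-app; subst; _≗_; _→-setoid_; module ≡-Reasoning)

module PowerSeries where

  open import Data.Nat as ℕ using (zero; _∸_; _<_; _≤?_; _≟_; s≤s)
  import Data.Nat.Properties as ℕ
  open import Data.Integer using (_+_; _*_; _-_; -_)
  import Data.Integer.Properties as ℤ
  open import Data.Integer.Tactic.RingSolver using (solve-∀)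
  open import Data.Nat.Tactic.RingSolver using () renaming (solve-∀ to ℕ-solve-∀)
  open import Data.List using ([]; _∷_; upTo; applyUpTo; zipWith)
  open import Data.Nat.Induction using (<-rec)
  import Data.List.Properties as List
  import Data.List.Relation.Unary.All as All
  open import Data.List.Relation.Unary.All.Properties using (all-upTo)
  open import Algebra.Bundles using (CommutativeMonoid)
  open import Algebra.Properties.CommutativeSemigroup ℤ.+-commutativeSemigroup
    using () renaming (interchange to +-interchange)
  open import Data.Bool using (true; false; if_then_else_)
  open import Relation.Nullary using (does)
  open import Relation.Nullary.Decidable using (dec-false; does-⇔)
  open import Function.Bundles using (mk⇔)
  open import Function using (_∘_)

  open Setoid (ℕ →-setoid ℤ) public
    using () renaming (refl to ≗-refl; sym to ≗-sym; trans to ≗-trans)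
  import Relation.Binary.Reasoning.Setoid as SetoidReasoning
  module ≗-Reasoning = SetoidReasoning (ℕ →-setoid ℤ)

  infixl 6 _⊕_ _⊖_
  infixr 7 _·_

  _⊕_ _⊖_ : Series → Series → Series
  (f ⊕ g) n = f n + g n
  (f ⊖ g) n = f n - g n

  _·_ : ℤ → Series → Series
  (c · f) n = c * f n

  𝟘 : Series
  𝟘 _ = + 0

  tail : Series → Series
  tail f n = f (suc n)

  ⊕-cong : ∀ {f f′ g g′} → f ≗ f′ → g ≗ g′ → f ⊕ g ≗ f′ ⊕ g′
  ⊕-cong e e′ n = cong₂ _+_ (e n) (e′ n)

  ⊖-cong : ∀ {f f′ g g′} → f ≗ f′ → g ≗ g′ → f ⊖ g ≗ f′ ⊖ g′
  ⊖-cong e e′ n = cong₂ _-_ (e n) (e′ n)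

  ∑< : ℕ → (ℕ → ℤ) → ℤ
  ∑< n F = sumℤ (map F (upTo n))

  ∑<-suc : ∀ n F → ∑< (suc n) F ≡ F 0 + ∑< n (F ∘ suc)
  ∑<-suc n F = cong (λ xs → F 0 + sumℤ xs)
    (trans (List.map-applyUpTo suc F n) (sym (List.map-upTo (F ∘ suc) n)))

  ∑<-sucʳ : ∀ n F → ∑< (suc n) F ≡ ∑< n F + F n
  ∑<-sucʳ zero    F = ℤ.+-comm (F 0) (+ 0)
  ∑<-sucʳ (suc n) F = begin
    ∑< (suc (suc n)) F                  ≡⟨ ∑<-suc (suc n) F ⟩
    F 0 + ∑< (suc n) (F ∘ suc)          ≡⟨ cong (_+_ (F 0)) (∑<-sucʳ n (F ∘ suc)) ⟩
    F 0 + (∑< n (F ∘ suc) + F (suc n))  ≡⟨ ℤ.+-assoc (F 0) _ _ ⟨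
    F 0 + ∑< n (F ∘ suc) + F (suc n)    ≡⟨ cong (_+ F (suc n)) (∑<-suc n F) ⟨
    ∑< (suc n) F + F (suc n)            ∎
    where open ≡-Reasoning

  ∑<-cong : ∀ n {F G} → (∀ {i} → i < n → F i ≡ G i) → ∑< n F ≡ ∑< n G
  ∑<-cong n e = cong sumℤ (List.map-cong-local (All.map e (all-upTo n)))

  ∑<-reverse : ∀ n F → ∑< (suc n) F ≡ ∑< (suc n) (λ i → F (n ∸ i))
  ∑<-reverse zero    F = refl
  ∑<-reverse (suc n) F = begin
    ∑< (suc (suc n)) F                        ≡⟨ ∑<-suc (suc n) F ⟩
    F 0 + ∑< (suc n) (F ∘ suc)                ≡⟨ cong (_+_ (F 0)) (∑<-reverse n (F ∘ suc)) ⟩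
    F 0 + ∑< (suc n) (λ i → F (suc (n ∸ i)))  ≡⟨ ℤ.+-comm (F 0) _ ⟩
    ∑< (suc n) (λ i → F (suc (n ∸ i))) + F 0  ≡⟨ cong₂ _+_ (∑<-cong (suc n) λ i≤n →
                                                   cong F (sym (ℕ.+-∸-assoc 1 (ℕ.≤-pred i≤n))))
                                                 (cong F (sym (ℕ.n∸n≡0 n))) ⟩
    ∑< (suc n) (λ i → F (suc n ∸ i)) + F (suc n ∸ suc n) ≡⟨ ∑<-sucʳ (suc n) (λ i → F (suc n ∸ i)) ⟨
    ∑< (suc (suc n)) (λ i → F (suc n ∸ i))    ∎
    where open ≡-Reasoning

  sumℤ-map-+ : ∀ (F G : ℕ → ℤ) xs → sumℤ (map (λ i → F i + G i) xs) ≡ sumℤ (map F xs) + sumℤ (map G xs)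
  sumℤ-map-+ F G []       = refl
  sumℤ-map-+ F G (x ∷ xs) =
    trans (cong (_+_ (F x + G x)) (sumℤ-map-+ F G xs)) (+-interchange (F x) (G x) _ _)

  sumℤ-map-- : ∀ (F G : ℕ → ℤ) xs → sumℤ (map (λ i → F i - G i) xs) ≡ sumℤ (map F xs) - sumℤ (map G xs)
  sumℤ-map-- F G []       = refl
  sumℤ-map-- F G (x ∷ xs) =
    trans (cong (_+_ (F x - G x)) (sumℤ-map-- F G xs)) (rearrange (F x) (G x) _ _)
    where
    rearrange : ∀ a b c d → (a - b) + (c - d) ≡ (a + c) - (b + d)
    rearrange = solve-∀

  sumℤ-map-*ˡ : ∀ c (F : ℕ → ℤ) xs → sumℤ (map (λ i → c * F i) xs) ≡ c * sumℤ (map F xs)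
  sumℤ-map-*ˡ c F []       = sym (ℤ.*-zeroʳ c)
  sumℤ-map-*ˡ c F (x ∷ xs) =
    trans (cong (_+_ (c * F x)) (sumℤ-map-*ˡ c F xs)) (sym (ℤ.*-distribˡ-+ c (F x) _))

  sumℤ-map-𝟘 : ∀ (xs : List ℕ) → sumℤ (map 𝟘 xs) ≡ + 0
  sumℤ-map-𝟘 []       = refl
  sumℤ-map-𝟘 (x ∷ xs) = trans (ℤ.+-identityˡ _) (sumℤ-map-𝟘 xs)

  ⊛-suc : ∀ f g n → (f ⊛ g) (suc n) ≡ f 0 * g (suc n) + (tail f ⊛ g) n
  ⊛-suc f g n = ∑<-suc (suc n) (λ i → f i * g (suc n ∸ i))

  ⊛-cong : ∀ {f f′ g g′} → f ≗ f′ → g ≗ g′ → f ⊛ g ≗ f′ ⊛ g′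
  ⊛-cong e e′ n = cong sumℤ (List.map-cong (λ i → cong₂ _*_ (e i) (e′ (n ∸ i))) (upTo (suc n)))

  ⊛-congˡ : ∀ f {g g′} → g ≗ g′ → f ⊛ g ≗ f ⊛ g′
  ⊛-congˡ f = ⊛-cong {f = f} ≗-refl

  ⊛-congʳ : ∀ {f f′} g → f ≗ f′ → f ⊛ g ≗ f′ ⊛ g
  ⊛-congʳ g f≗f′ = ⊛-cong f≗f′ ≗-refl

  ⊛-comm : ∀ f g → f ⊛ g ≗ g ⊛ f
  ⊛-comm f g n = begin
    ∑< (suc n) (λ i → f i * g (n ∸ i))              ≡⟨ ∑<-reverse n (λ i → f i * g (n ∸ i)) ⟩
    ∑< (suc n) (λ i → f (n ∸ i) * g (n ∸ (n ∸ i)))  ≡⟨ ∑<-cong (suc n) (λ {i} i≤n →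
      trans (cong (λ j → f (n ∸ i) * g j) (ℕ.m∸[m∸n]≡n (ℕ.≤-pred i≤n))) (ℤ.*-comm (f (n ∸ i)) (g i))) ⟩
    ∑< (suc n) (λ i → g i * f (n ∸ i))              ∎
    where open ≡-Reasoning

  ⊛-distribʳ-⊕ : ∀ f g h → (f ⊕ g) ⊛ h ≗ f ⊛ h ⊕ g ⊛ h
  ⊛-distribʳ-⊕ f g h n =
    trans (cong sumℤ (List.map-cong (λ i → ℤ.*-distribʳ-+ (h (n ∸ i)) (f i) (g i)) (upTo (suc n))))
          (sumℤ-map-+ (λ i → f i * h (n ∸ i)) (λ i → g i * h (n ∸ i)) (upTo (suc n)))

  ⊛-distribʳ-⊖ : ∀ f g h → (f ⊖ g) ⊛ h ≗ f ⊛ h ⊖ g ⊛ h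
  ⊛-distribʳ-⊖ f g h n =
    trans (cong sumℤ (List.map-cong (λ i → distrib (f i) (g i) (h (n ∸ i))) (upTo (suc n))))
          (sumℤ-map-- (λ i → f i * h (n ∸ i)) (λ i → g i * h (n ∸ i)) (upTo (suc n)))
    where
    distrib : ∀ a b c → (a - b) * c ≡ a * c - b * c
    distrib = solve-∀

  ⊛-scaleˡ : ∀ c f g → (c · f) ⊛ g ≗ c · (f ⊛ g)
  ⊛-scaleˡ c f g n =
    trans (cong sumℤ (List.map-cong (λ i → ℤ.*-assoc c (f i) (g (n ∸ i))) (upTo (suc n))))
          (sumℤ-map-*ˡ c (λ i → f i * g (n ∸ i)) (upTo (suc n)))

  ⊛-zeroˡ : ∀ g → 𝟘 ⊛ g ≗ 𝟘
  ⊛-zeroˡ g n = sumℤ-map-𝟘 (upTo (suc n))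

  ⊛-identityˡ : ∀ f → one ⊛ f ≗ f
  ⊛-identityˡ f zero    = trans (ℤ.+-identityʳ _) (ℤ.*-identityˡ (f 0))
  -- tail one computes to 𝟘
  ⊛-identityˡ f (suc n) =
    trans (⊛-suc one f n) (trans (cong₂ _+_ (ℤ.*-identityˡ (f (suc n))) (⊛-zeroˡ f n)) (ℤ.+-identityʳ _))

  ⊛-assoc : ∀ f g h → (f ⊛ g) ⊛ h ≗ f ⊛ (g ⊛ h)
  ⊛-assoc f g h zero    = constant (f 0) (g 0) (h 0)
    where
    constant : ∀ a b c → (a * b + + 0) * c + + 0 ≡ a * (b * c + + 0) + + 0
    constant = solve-∀
  ⊛-assoc f g h (suc n) = begin
    ((f ⊛ g) ⊛ h) (suc n)                                ≡⟨ ⊛-suc (f ⊛ g) h n ⟩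
    (f ⊛ g) 0 * h (suc n) + (tail (f ⊛ g) ⊛ h) n         ≡⟨ cong (_+_ ((f ⊛ g) 0 * h (suc n))) tail-step ⟩
    (f ⊛ g) 0 * h (suc n) + (f 0 * (tail g ⊛ h) n + (tail f ⊛ (g ⊛ h)) n)
      ≡⟨ rearrange (f 0) (g 0) (h (suc n)) _ _ ⟩
    f 0 * (g 0 * h (suc n) + (tail g ⊛ h) n) + (tail f ⊛ (g ⊛ h)) n
      ≡⟨ cong (λ x → f 0 * x + (tail f ⊛ (g ⊛ h)) n) (⊛-suc g h n) ⟨
    f 0 * (g ⊛ h) (suc n) + (tail f ⊛ (g ⊛ h)) n         ≡⟨ ⊛-suc f (g ⊛ h) n ⟨
    (f ⊛ (g ⊛ h)) (suc n)                                ∎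
    where
    open ≡-Reasoning
    rearrange : ∀ a b c x y → (a * b + + 0) * c + (a * x + y) ≡ a * (b * c + x) + y
    rearrange = solve-∀
    tail-step : (tail (f ⊛ g) ⊛ h) n ≡ f 0 * (tail g ⊛ h) n + (tail f ⊛ (g ⊛ h)) n
    tail-step = begin
      (tail (f ⊛ g) ⊛ h) n                        ≡⟨ ⊛-congʳ h (⊛-suc f g) n ⟩
      ((f 0 · tail g ⊕ tail f ⊛ g) ⊛ h) n         ≡⟨ ⊛-distribʳ-⊕ (f 0 · tail g) (tail f ⊛ g) h n ⟩
      ((f 0 · tail g) ⊛ h) n + ((tail f ⊛ g) ⊛ h) n
        ≡⟨ cong₂ _+_ (⊛-scaleˡ (f 0) (tail g) h n) (⊛-assoc (tail f) g h n) ⟩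
      f 0 * (tail g ⊛ h) n + (tail f ⊛ (g ⊛ h)) n ∎

  ⊛-commutativeMonoid : CommutativeMonoid 0ℓ 0ℓ
  ⊛-commutativeMonoid = record
    { Carrier             = Series
    ; _≈_                 = _≗_
    ; _∙_                 = _⊛_
    ; ε                   = one
    ; isCommutativeMonoid = record
      { isMonoid = record
        { isSemigroup = record
          { isMagma = record { isEquivalence = Setoid.isEquivalence (ℕ →-setoid ℤ) ; ∙-cong = ⊛-cong }
          ; assoc   = ⊛-assoc
          }
        ; identity = ⊛-identityˡ , λ f → ≗-trans (⊛-comm f one) (⊛-identityˡ f)
        }
      ; comm = ⊛-comm
      }
    }

  ⊛-identityʳ : ∀ f → f ⊛ one ≗ f
  ⊛-identityʳ = CommutativeMonoid.identityʳ ⊛-commutativeMonoid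

  open import Algebra.Properties.CommutativeSemigroup
    (CommutativeMonoid.commutativeSemigroup ⊛-commutativeMonoid) public
    using (x∙yz≈xz∙y; xy∙z≈xz∙y; xy∙z≈zy∙x) renaming (interchange to ⊛-interchange)

  ⊛-constant : ∀ f g → (f ⊛ g) 0 ≡ f 0 * g 0
  ⊛-constant f g = ℤ.+-identityʳ (f 0 * g 0)

  tail-shift : ∀ e f → tail (shift (suc e) f) ≗ shift e f
  tail-shift e f n = cong (λ b → if b then f (n ∸ e) else + 0)
    (does-⇔ (mk⇔ ℕ.≤-pred s≤s) (suc e ≤? suc n) (e ≤? n))

  shift-≡ : ∀ {e d} f → e ≡ d → shift e f ≗ shift d f
  shift-≡ f eq = cong-app (cong (λ e → shift e f) eq)

  shift-cong : ∀ e {f g} → f ≗ g → shift e f ≗ shift e g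
  shift-cong e f≗g n with does (e ≤? n)
  ... | true  = f≗g (n ∸ e)
  ... | false = refl

  shift-⊕ : ∀ e f g → shift e (f ⊕ g) ≗ shift e f ⊕ shift e g
  shift-⊕ e f g n with does (e ≤? n)
  ... | true  = refl
  ... | false = refl

  shift-⊖ : ∀ e f g → shift e (f ⊖ g) ≗ shift e f ⊖ shift e g
  shift-⊖ e f g n with does (e ≤? n)
  ... | true  = refl
  ... | false = refl

  shift-𝟘 : ∀ e → shift e 𝟘 ≗ 𝟘
  shift-𝟘 e n with does (e ≤? n)
  ... | true  = refl
  ... | false = refl

  shift-below : ∀ e f {i} → i < e → shift e f i ≡ + 0
  shift-below e f {i} i<e = cong (λ b → if b then f (i ∸ e) else + 0) (dec-false (e ≤? i) (ℕ.<⇒≱ i<e))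

  shift-+ : ∀ e d f → shift e (shift d f) ≗ shift (e ℕ.+ d) f
  shift-+ zero    d f n       = refl
  shift-+ (suc e) d f zero    = refl
  shift-+ (suc e) d f (suc n) =
    trans (tail-shift e (shift d f) n) (trans (shift-+ e d f n) (sym (tail-shift (e ℕ.+ d) f n)))

  shift-⊛ : ∀ e f g → shift e f ⊛ g ≗ shift e (f ⊛ g)
  shift-⊛ zero    f g n       = refl
  shift-⊛ (suc e) f g zero    = refl
  shift-⊛ (suc e) f g (suc n) = begin
    (shift (suc e) f ⊛ g) (suc n)                     ≡⟨ ⊛-suc (shift (suc e) f) g n ⟩
    + 0 * g (suc n) + (tail (shift (suc e) f) ⊛ g) n  ≡⟨ ℤ.+-identityˡ _ ⟩
    (tail (shift (suc e) f) ⊛ g) n                    ≡⟨ ⊛-congʳ g (tail-shift e f) n ⟩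
    (shift e f ⊛ g) n                                 ≡⟨ shift-⊛ e f g n ⟩
    shift e (f ⊛ g) n                                 ≡⟨ tail-shift e (f ⊛ g) n ⟨
    shift (suc e) (f ⊛ g) (suc n)                     ∎
    where open ≡-Reasoning

  shift-one : ∀ e n → shift e one n ≡ (if does (n ≟ e) then + 1 else + 0)
  shift-one zero    n       = refl
  shift-one (suc e) zero    = refl
  shift-one (suc e) (suc n) = trans (tail-shift e one n) (shift-one e n)

  ⊛-oneMinusQ : ∀ f e → f ⊛ oneMinusQ e ≗ f ⊖ shift e f
  ⊛-oneMinusQ f e = begin
    f ⊛ oneMinusQ e                   ≈⟨ ⊛-comm f (oneMinusQ e) ⟩
    oneMinusQ e ⊛ f                   ≈⟨ ⊛-congʳ f (λ n → cong (_-_ (one n)) (sym (shift-one e n))) ⟩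
    (one ⊖ shift e one) ⊛ f           ≈⟨ ⊛-distribʳ-⊖ one (shift e one) f ⟩
    one ⊛ f ⊖ shift e one ⊛ f         ≈⟨ ⊖-cong (⊛-identityˡ f) (shift-⊛ e one f) ⟩
    f ⊖ shift e (one ⊛ f)             ≈⟨ ⊖-cong {f = f} ≗-refl (shift-cong e (⊛-identityˡ f)) ⟩
    f ⊖ shift e f                     ∎
    where open ≗-Reasoning

  ⊛-oneMinusQ-+ : ∀ f i j → f ⊛ oneMinusQ i ⊕ shift i (f ⊛ oneMinusQ j) ≗ f ⊛ oneMinusQ (i ℕ.+ j)
  ⊛-oneMinusQ-+ f i j = begin
    f ⊛ oneMinusQ i ⊕ shift i (f ⊛ oneMinusQ j)        ≈⟨ ⊕-cong (⊛-oneMinusQ f i) (shift-cong i (⊛-oneMinusQ f j)) ⟩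
    (f ⊖ shift i f) ⊕ shift i (f ⊖ shift j f)          ≈⟨ ⊕-cong {f = f ⊖ shift i f} ≗-refl (≗-trans
                                                            (shift-⊖ i f (shift j f))
                                                            (⊖-cong {f = shift i f} ≗-refl (shift-+ i j f))) ⟩
    (f ⊖ shift i f) ⊕ (shift i f ⊖ shift (i ℕ.+ j) f)  ≈⟨ (λ n → cancel (f n) (shift i f n) (shift (i ℕ.+ j) f n)) ⟩
    f ⊖ shift (i ℕ.+ j) f                              ≈⟨ ⊛-oneMinusQ f (i ℕ.+ j) ⟨
    f ⊛ oneMinusQ (i ℕ.+ j)                            ∎
    where
    open ≗-Reasoning
    cancel : ∀ x y z → (x - y) + (y - z) ≡ x - z
    cancel = solve-∀

  zipWith-map-suc : ∀ (h : ℕ → ℤ → ℤ) (k : ℕ → ℤ) xs →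
                    zipWith h (map suc xs) (map k xs) ≡ map (λ i → h (suc i) (k i)) xs
  zipWith-map-suc h k []       = refl
  zipWith-map-suc h k (x ∷ xs) = cong (h (suc x) (k x) ∷_) (zipWith-map-suc h k xs)

  invList-upTo : ∀ f n → invList f n ≡ map (λ i → inv f (n ∸ i)) (upTo (suc n))
  invList-upTo f zero    = refl
  invList-upTo f (suc n) = cong (inv f (suc n) ∷_) (begin
    invList f n                                      ≡⟨ invList-upTo f n ⟩
    map (λ i → inv f (n ∸ i)) (upTo (suc n))         ≡⟨ List.map-upTo _ (suc n) ⟩
    applyUpTo (λ i → inv f (suc n ∸ suc i)) (suc n)  ≡⟨ List.map-applyUpTo suc _ (suc n) ⟨
    map (λ i → inv f (suc n ∸ i)) (applyUpTo suc (suc n)) ∎)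
    where open ≡-Reasoning

  inv-suc : ∀ f n → inv f (suc n) ≡ - ∑< (suc n) (λ i → f (suc i) * inv f (n ∸ i))
  inv-suc f n = cong (λ xs → - sumℤ xs) (trans
    (cong (zipWith (λ i g → f i * g) (map suc (upTo (suc n)))) (invList-upTo f n))
    (zipWith-map-suc (λ i g → f i * g) (λ i → inv f (n ∸ i)) (upTo (suc n))))

  ⊛-inverseʳ : ∀ f → f 0 ≡ + 1 → f ⊛ inv f ≗ one
  ⊛-inverseʳ f f₀≡1 zero    = trans (⊛-constant f (inv f)) (cong (_* + 1) f₀≡1)
  ⊛-inverseʳ f f₀≡1 (suc n) = begin
    (f ⊛ inv f) (suc n)                  ≡⟨ ⊛-suc f (inv f) n ⟩
    f 0 * inv f (suc n) + S               ≡⟨ cong₂ (λ a b → a * b + S) f₀≡1 (inv-suc f n) ⟩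
    + 1 * - S + S                         ≡⟨ cong (_+ S) (ℤ.*-identityˡ (- S)) ⟩
    - S + S                               ≡⟨ ℤ.+-inverseˡ S ⟩
    + 0                                   ∎
    where
    open ≡-Reasoning
    S : ℤ
    S = ∑< (suc n) (λ i → f (suc i) * inv f (n ∸ i))

  ⊛-inverseˡ : ∀ f → f 0 ≡ + 1 → inv f ⊛ f ≗ one
  ⊛-inverseˡ f f₀≡1 = ≗-trans (⊛-comm (inv f) f) (⊛-inverseʳ f f₀≡1)

  ⊛-cancelʳ : ∀ {g g′} f → f 0 ≡ + 1 → g ⊛ f ≗ g′ ⊛ f → g ≗ g′
  ⊛-cancelʳ {g} {g′} f f₀≡1 eq = begin
    g                   ≈⟨ ⊛-identityʳ g ⟨
    g ⊛ one             ≈⟨ ⊛-congˡ g (⊛-inverseʳ f f₀≡1) ⟨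
    g ⊛ (f ⊛ inv f)     ≈⟨ ⊛-assoc g f (inv f) ⟨
    (g ⊛ f) ⊛ inv f     ≈⟨ ⊛-congʳ (inv f) eq ⟩
    (g′ ⊛ f) ⊛ inv f    ≈⟨ ⊛-assoc g′ f (inv f) ⟩
    g′ ⊛ (f ⊛ inv f)    ≈⟨ ⊛-congˡ g′ (⊛-inverseʳ f f₀≡1) ⟩
    g′ ⊛ one            ≈⟨ ⊛-identityʳ g′ ⟩
    g′                  ∎
    where open ≗-Reasoning

  ⊛-inverse-pair : ∀ f g → f 0 ≡ + 1 → g 0 ≡ + 1 → (f ⊛ g) ⊛ (inv f ⊛ inv g) ≗ one
  ⊛-inverse-pair f g f₀≡1 g₀≡1 = begin
    (f ⊛ g) ⊛ (inv f ⊛ inv g)    ≈⟨ ⊛-interchange f g (inv f) (inv g) ⟩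
    (f ⊛ inv f) ⊛ (g ⊛ inv g)    ≈⟨ ⊛-cong (⊛-inverseʳ f f₀≡1) (⊛-inverseʳ g g₀≡1) ⟩
    one ⊛ one                    ≈⟨ ⊛-identityˡ one ⟩
    one                          ∎
    where open ≗-Reasoning

  ⊛-divide : ∀ {h h′} f g → f 0 ≡ + 1 → g 0 ≡ + 1 → h ⊛ (f ⊛ g) ≗ h′ → h ≗ h′ ⊛ (inv f ⊛ inv g)
  ⊛-divide {h} {h′} f g f₀≡1 g₀≡1 eq = begin
    h                                    ≈⟨ ⊛-identityʳ h ⟨
    h ⊛ one                              ≈⟨ ⊛-congˡ h (⊛-inverse-pair f g f₀≡1 g₀≡1) ⟨
    h ⊛ ((f ⊛ g) ⊛ (inv f ⊛ inv g))      ≈⟨ ⊛-assoc h (f ⊛ g) _ ⟨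
    (h ⊛ (f ⊛ g)) ⊛ (inv f ⊛ inv g)      ≈⟨ ⊛-congʳ (inv f ⊛ inv g) eq ⟩
    h′ ⊛ (inv f ⊛ inv g)                 ∎
    where open ≗-Reasoning

  infix 4 _≗[≤_]_
  _≗[≤_]_ : Series → ℕ → Series → Set
  f ≗[≤ n ] g = ∀ {i} → i ℕ.≤ n → f i ≡ g i

  ⊛-coeff-congʳ : ∀ {f f′} g n → f ≗[≤ n ] f′ → (f ⊛ g) n ≡ (f′ ⊛ g) n
  ⊛-coeff-congʳ g n f≗f′ = ∑<-cong (suc n) (λ {i} i<1+n → cong (_* g (n ∸ i)) (f≗f′ (ℕ.≤-pred i<1+n)))

  inv-cong-≤ : ∀ {f g} n → f ≗[≤ n ] g → inv f ≗[≤ n ] inv g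
  inv-cong-≤ {f} {g} n f≗g {i} = <-rec (λ i → i ℕ.≤ n → inv f i ≡ inv g i) step i
    where
    step : ∀ i → (∀ {j} → j < i → j ℕ.≤ n → inv f j ≡ inv g j) → i ℕ.≤ n → inv f i ≡ inv g i
    step zero    _  _     = refl
    step (suc i) ih 1+i≤n = begin
      inv f (suc i)                                    ≡⟨ inv-suc f i ⟩
      - ∑< (suc i) (λ l → f (suc l) * inv f (i ∸ l))   ≡⟨ cong -_ (∑<-cong (suc i) λ {l} l<1+i →
        cong₂ _*_ (f≗g (ℕ.≤-trans l<1+i 1+i≤n))
                  (ih (s≤s (ℕ.m∸n≤m i l)) (ℕ.≤-trans (ℕ.m∸n≤m i l) (ℕ.≤-trans (ℕ.n≤1+n i) 1+i≤n)))) ⟩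
      - ∑< (suc i) (λ l → g (suc l) * inv g (i ∸ l))   ≡⟨ inv-suc g i ⟨
      inv g (suc i)                                    ∎
      where open ≡-Reasoning

  pochFin-suc : ∀ a i → pochFin a (suc i) ≡ oneMinusQ a ⊛ pochFin (suc a) i
  pochFin-suc a i = cong₂ (λ x xs → x ⊛ prodSeries xs) (cong oneMinusQ (ℕ.+-identityʳ a)) (begin
    map (λ t → oneMinusQ (a ℕ.+ t)) (applyUpTo suc i)  ≡⟨ List.map-applyUpTo suc _ i ⟩
    applyUpTo (λ t → oneMinusQ (a ℕ.+ suc t)) i        ≡⟨ List.map-upTo _ i ⟨
    map (λ t → oneMinusQ (a ℕ.+ suc t)) (upTo i)       ≡⟨ List.map-cong (cong oneMinusQ ∘ ℕ.+-suc a) (upTo i) ⟩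
    map (λ t → oneMinusQ (suc a ℕ.+ t)) (upTo i)       ∎)
    where open ≡-Reasoning

  pochFin-+ : ∀ a i j → pochFin a (i ℕ.+ j) ≗ pochFin a i ⊛ pochFin (a ℕ.+ i) j
  pochFin-+ a zero    j = begin
    pochFin a j                   ≡⟨ cong (λ b → pochFin b j) (ℕ.+-identityʳ a) ⟨
    pochFin (a ℕ.+ 0) j           ≈⟨ ⊛-identityˡ (pochFin (a ℕ.+ 0) j) ⟨
    one ⊛ pochFin (a ℕ.+ 0) j     ∎
    where open ≗-Reasoning
  pochFin-+ a (suc i) j = begin
    pochFin a (suc (i ℕ.+ j))                                   ≡⟨ pochFin-suc a (i ℕ.+ j) ⟩
    oneMinusQ a ⊛ pochFin (suc a) (i ℕ.+ j)                     ≈⟨ ⊛-congˡ (oneMinusQ a) (pochFin-+ (suc a) i j) ⟩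
    oneMinusQ a ⊛ (pochFin (suc a) i ⊛ pochFin (suc a ℕ.+ i) j) ≈⟨ ⊛-assoc (oneMinusQ a) _ _ ⟨
    (oneMinusQ a ⊛ pochFin (suc a) i) ⊛ pochFin (suc a ℕ.+ i) j ≡⟨ cong₂ _⊛_ (pochFin-suc a i)
                                                                        (cong (λ b → pochFin b j) (ℕ.+-suc a i)) ⟨
    pochFin a (suc i) ⊛ pochFin (a ℕ.+ suc i) j                 ∎
    where open ≗-Reasoning

  pochFin-sucʳ : ∀ a i → pochFin a (suc i) ≗ pochFin a i ⊛ oneMinusQ (a ℕ.+ i)
  pochFin-sucʳ a i = begin
    pochFin a (suc i)                         ≡⟨ cong (pochFin a) (ℕ.+-comm 1 i) ⟩
    pochFin a (i ℕ.+ 1)                       ≈⟨ pochFin-+ a i 1 ⟩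
    pochFin a i ⊛ (oneMinusQ (a ℕ.+ i ℕ.+ 0) ⊛ one) ≈⟨ ⊛-congˡ (pochFin a i) (⊛-identityʳ _) ⟩
    pochFin a i ⊛ oneMinusQ (a ℕ.+ i ℕ.+ 0)   ≡⟨ cong (λ e → pochFin a i ⊛ oneMinusQ e) (ℕ.+-identityʳ (a ℕ.+ i)) ⟩
    pochFin a i ⊛ oneMinusQ (a ℕ.+ i)         ∎
    where open ≗-Reasoning

  pochFin-constant : ∀ a i → pochFin (suc a) i 0 ≡ + 1
  pochFin-constant a zero    = refl
  pochFin-constant a (suc i) = begin
    pochFin (suc a) (suc i) 0                         ≡⟨ cong-app (pochFin-suc (suc a) i) 0 ⟩
    (oneMinusQ (suc a) ⊛ pochFin (suc (suc a)) i) 0   ≡⟨ ⊛-constant (oneMinusQ (suc a)) (pochFin (suc (suc a)) i) ⟩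
    + 1 * pochFin (suc (suc a)) i 0                   ≡⟨ cong (+ 1 *_) (pochFin-constant (suc a) i) ⟩
    + 1                                               ∎
    where open ≡-Reasoning

  pochFin-coeff-extend : ∀ a j d {i} → i < a ℕ.+ j → pochFin a (j ℕ.+ d) i ≡ pochFin a j i
  pochFin-coeff-extend a j zero    i<a+j = cong (λ l → pochFin a l _) (ℕ.+-identityʳ j)
  pochFin-coeff-extend a j (suc d) {i} i<a+j = begin
    pochFin a (j ℕ.+ suc d) i                            ≡⟨ cong (λ l → pochFin a l i) (ℕ.+-suc j d) ⟩
    pochFin a (suc (j ℕ.+ d)) i                          ≡⟨ pochFin-sucʳ a (j ℕ.+ d) i ⟩
    (pochFin a (j ℕ.+ d) ⊛ oneMinusQ (a ℕ.+ (j ℕ.+ d))) i ≡⟨ ⊛-oneMinusQ (pochFin a (j ℕ.+ d)) _ i ⟩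
    pochFin a (j ℕ.+ d) i - shift (a ℕ.+ (j ℕ.+ d)) (pochFin a (j ℕ.+ d)) i
      ≡⟨ cong (_-_ (pochFin a (j ℕ.+ d) i)) (shift-below (a ℕ.+ (j ℕ.+ d)) (pochFin a (j ℕ.+ d)) (ℕ.<-≤-trans i<a+j
           (ℕ.≤-trans (ℕ.m≤m+n (a ℕ.+ j) d) (ℕ.≤-reflexive (ℕ.+-assoc a j d))))) ⟩
    pochFin a (j ℕ.+ d) i - + 0                          ≡⟨ ℤ.+-identityʳ _ ⟩
    pochFin a (j ℕ.+ d) i                                ≡⟨ pochFin-coeff-extend a j d i<a+j ⟩
    pochFin a j i                                        ∎
    where open ≡-Reasoning

  pochInf-≗[≤] : ∀ a {n J} → n < J → pochInf a ≗[≤ n ] pochFin a J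
  pochInf-≗[≤] a {n} {J} n<J {i} i≤n = begin
    pochFin a (suc i) i                  ≡⟨ pochFin-coeff-extend a (suc i) (J ∸ suc i) (ℕ.m≤n+m (suc i) a) ⟨
    pochFin a (suc i ℕ.+ (J ∸ suc i)) i  ≡⟨ cong (λ l → pochFin a l i) (ℕ.m+[n∸m]≡n (ℕ.≤-<-trans i≤n n<J)) ⟩
    pochFin a J i                        ∎
    where open ≡-Reasoning

  ∑ˢ : ℕ → (ℕ → Series) → Series
  ∑ˢ t F n = ∑< t (λ a → F a n)

  ∑ˢ-sucʳ : ∀ t F → ∑ˢ (suc t) F ≗ ∑ˢ t F ⊕ F t
  ∑ˢ-sucʳ t F n = ∑<-sucʳ t (λ a → F a n)

  ∑ˢ-cong : ∀ t {F G} → (∀ {a} → a < t → F a ≗ G a) → ∑ˢ t F ≗ ∑ˢ t G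
  ∑ˢ-cong t F≗G n = ∑<-cong t (λ a<t → F≗G a<t n)

  ∑ˢ-⊛ : ∀ t F g → ∑ˢ t F ⊛ g ≗ ∑ˢ t (λ a → F a ⊛ g)
  ∑ˢ-⊛ zero    F g = ⊛-zeroˡ g
  ∑ˢ-⊛ (suc t) F g = begin
    ∑ˢ (suc t) F ⊛ g                  ≈⟨ ⊛-congʳ g (∑ˢ-sucʳ t F) ⟩
    (∑ˢ t F ⊕ F t) ⊛ g                ≈⟨ ⊛-distribʳ-⊕ (∑ˢ t F) (F t) g ⟩
    ∑ˢ t F ⊛ g ⊕ F t ⊛ g              ≈⟨ ⊕-cong (∑ˢ-⊛ t F g) ≗-refl ⟩
    ∑ˢ t (λ a → F a ⊛ g) ⊕ F t ⊛ g    ≈⟨ ∑ˢ-sucʳ t (λ a → F a ⊛ g) ⟨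
    ∑ˢ (suc t) (λ a → F a ⊛ g)        ∎
    where open ≗-Reasoning

  ∑ˢ-extend : ∀ t d F → (∀ {a} → t ℕ.≤ a → F a ≗ 𝟘) → ∑ˢ (d ℕ.+ t) F ≗ ∑ˢ t F
  ∑ˢ-extend t zero    F vanish = ≗-refl
  ∑ˢ-extend t (suc d) F vanish n = begin
    ∑ˢ (suc d ℕ.+ t) F n                ≡⟨ ∑ˢ-sucʳ (d ℕ.+ t) F n ⟩
    ∑ˢ (d ℕ.+ t) F n + F (d ℕ.+ t) n    ≡⟨ cong₂ _+_ (∑ˢ-extend t d F vanish n) (vanish (ℕ.m≤n+m t d) n) ⟩
    ∑ˢ t F n + + 0                      ≡⟨ ℤ.+-identityʳ _ ⟩
    ∑ˢ t F n                            ∎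
    where open ≡-Reasoning

  sumSeries-upTo : ∀ t F → sumSeries (map F (upTo t)) ≗ ∑ˢ t F
  sumSeries-upTo t F n = cong sumℤ (sym (List.map-∘ (upTo t)))

  telescope : ∀ m (H X : ℕ → Series) → H 0 ≗ 𝟘 →
              (∀ t → H (suc t) ⊛ oneMinusQ (m ℕ.+ t) ≗ H t ⊕ shift (m ℕ.+ t) (X t)) →
              ∀ t → H t ⊛ pochFin m t ≗ ∑ˢ t (λ a → shift (m ℕ.+ a) (X a ⊛ pochFin m a))
  telescope m H X H₀≗𝟘 step zero    = ≗-trans (⊛-identityʳ (H 0)) H₀≗𝟘
  telescope m H X H₀≗𝟘 step (suc t) = begin
    H (suc t) ⊛ pochFin m (suc t)                     ≈⟨ ⊛-congˡ (H (suc t)) (pochFin-sucʳ m t) ⟩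
    H (suc t) ⊛ (pochFin m t ⊛ oneMinusQ (m ℕ.+ t))   ≈⟨ x∙yz≈xz∙y (H (suc t)) (pochFin m t) _ ⟩
    (H (suc t) ⊛ oneMinusQ (m ℕ.+ t)) ⊛ pochFin m t   ≈⟨ ⊛-congʳ (pochFin m t) (step t) ⟩
    (H t ⊕ shift (m ℕ.+ t) (X t)) ⊛ pochFin m t       ≈⟨ ⊛-distribʳ-⊕ (H t) _ (pochFin m t) ⟩
    H t ⊛ pochFin m t ⊕ shift (m ℕ.+ t) (X t) ⊛ pochFin m t
      ≈⟨ ⊕-cong (telescope m H X H₀≗𝟘 step t) (shift-⊛ (m ℕ.+ t) (X t) (pochFin m t)) ⟩
    ∑ˢ t T ⊕ T t                                      ≈⟨ ∑ˢ-sucʳ t T ⟨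
    ∑ˢ (suc t) T                                      ∎
    where
    open ≗-Reasoning
    T : ℕ → Series
    T a = shift (m ℕ.+ a) (X a ⊛ pochFin m a)

  qFact : ℕ → Series
  qFact = pochFin 1

  qFact-sucʳ : ∀ i → qFact (suc i) ≗ qFact i ⊛ oneMinusQ (suc i)
  qFact-sucʳ = pochFin-sucʳ 1

  qFact-constant : ∀ i → qFact i 0 ≡ + 1
  qFact-constant = pochFin-constant 0

  module QBinomial (m : ℕ) (B : ℕ → ℕ → Series)
    (B-zero-zero : B 0 0 ≗ one)
    (B-zero-suc  : ∀ r → B 0 (suc r) ≗ shift m (B 0 r))
    (B-suc-zero  : ∀ a → B (suc a) 0 ≗ B a 0)
    (B-suc-suc   : ∀ a r → B (suc a) (suc r) ≗ B a (suc r) ⊕ shift (suc a ℕ.+ m) (B (suc a) r))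
    where

    private
      W : ℕ → ℕ → Series
      W a r = qFact a ⊛ qFact r

      W-sucˡ : ∀ a r → W (suc a) r ≗ W a r ⊛ oneMinusQ (suc a)
      W-sucˡ a r = ≗-trans (⊛-congʳ (qFact r) (qFact-sucʳ a)) (xy∙z≈xz∙y (qFact a) _ (qFact r))

      W-sucʳ : ∀ a r → W a (suc r) ≗ W a r ⊛ oneMinusQ (suc r)
      W-sucʳ a r = ≗-trans (⊛-congˡ (qFact a) (qFact-sucʳ r)) (≗-sym (⊛-assoc (qFact a) (qFact r) _))

      extend : ∀ X w e P j → X ⊛ w ≗ shift e P → X ⊛ (w ⊛ oneMinusQ j) ≗ shift e (P ⊛ oneMinusQ j)
      extend X w e P j eq =
        ≗-trans (≗-sym (⊛-assoc X w (oneMinusQ j))) (≗-trans (⊛-congʳ (oneMinusQ j) eq) (shift-⊛ e P (oneMinusQ j)))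

    qBinomial : ∀ a r → B a r ⊛ (qFact a ⊛ qFact r) ≗ shift (r ℕ.* m) (qFact (a ℕ.+ r))
    qBinomial zero zero = begin
      B 0 0 ⊛ (one ⊛ one)   ≈⟨ ⊛-cong B-zero-zero (⊛-identityˡ one) ⟩
      one ⊛ one             ≈⟨ ⊛-identityˡ one ⟩
      one                   ∎
      where open ≗-Reasoning
    qBinomial zero (suc r) = begin
      B 0 (suc r) ⊛ W 0 (suc r)                                ≈⟨ ⊛-cong (B-zero-suc r) (W-sucʳ 0 r) ⟩
      shift m (B 0 r) ⊛ (W 0 r ⊛ oneMinusQ (suc r))            ≈⟨ shift-⊛ m (B 0 r) (W 0 r ⊛ oneMinusQ (suc r)) ⟩
      shift m (B 0 r ⊛ (W 0 r ⊛ oneMinusQ (suc r)))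
        ≈⟨ shift-cong m (extend (B 0 r) (W 0 r) (r ℕ.* m) (qFact r) (suc r) (qBinomial 0 r)) ⟩
      shift m (shift (r ℕ.* m) (qFact r ⊛ oneMinusQ (suc r)))  ≈⟨ shift-+ m (r ℕ.* m) (qFact r ⊛ oneMinusQ (suc r)) ⟩
      shift (suc r ℕ.* m) (qFact r ⊛ oneMinusQ (suc r))        ≈⟨ shift-cong (suc r ℕ.* m) (qFact-sucʳ r) ⟨
      shift (suc r ℕ.* m) (qFact (suc r))                      ∎
      where open ≗-Reasoning
    qBinomial (suc a) zero = begin
      B (suc a) 0 ⊛ W (suc a) 0              ≈⟨ ⊛-cong (B-suc-zero a) (W-sucˡ a 0) ⟩
      B a 0 ⊛ (W a 0 ⊛ oneMinusQ (suc a))    ≈⟨ extend (B a 0) (W a 0) 0 (qFact (a ℕ.+ 0)) (suc a) (qBinomial a 0) ⟩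
      qFact (a ℕ.+ 0) ⊛ oneMinusQ (suc a)    ≡⟨ cong (λ j → qFact j ⊛ oneMinusQ (suc a)) (ℕ.+-identityʳ a) ⟩
      qFact a ⊛ oneMinusQ (suc a)            ≈⟨ qFact-sucʳ a ⟨
      qFact (suc a)                          ≡⟨ cong qFact (ℕ.+-identityʳ (suc a)) ⟨
      qFact (suc a ℕ.+ 0)                    ∎
      where open ≗-Reasoning
    qBinomial (suc a) (suc r) = begin
      B (suc a) (suc r) ⊛ W (suc a) (suc r)
        ≈⟨ ⊛-congʳ (W (suc a) (suc r)) (B-suc-suc a r) ⟩
      (B a (suc r) ⊕ shift (suc a ℕ.+ m) (B (suc a) r)) ⊛ W (suc a) (suc r)
        ≈⟨ ⊛-distribʳ-⊕ (B a (suc r)) (shift (suc a ℕ.+ m) (B (suc a) r)) (W (suc a) (suc r)) ⟩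
      B a (suc r) ⊛ W (suc a) (suc r) ⊕ shift (suc a ℕ.+ m) (B (suc a) r) ⊛ W (suc a) (suc r)
        ≈⟨ ⊕-cong (⊛-congˡ (B a (suc r)) (W-sucˡ a (suc r)))
                  (shift-⊛ (suc a ℕ.+ m) (B (suc a) r) (W (suc a) (suc r))) ⟩
      B a (suc r) ⊛ (W a (suc r) ⊛ oneMinusQ (suc a)) ⊕ shift (suc a ℕ.+ m) (B (suc a) r ⊛ W (suc a) (suc r))
        ≈⟨ ⊕-cong (extend (B a (suc r)) (W a (suc r)) E P (suc a) (qBinomial a (suc r)))
                  (shift-cong (suc a ℕ.+ m) (⊛-congˡ (B (suc a) r) (W-sucʳ (suc a) r))) ⟩
      shift E (P ⊛ oneMinusQ (suc a)) ⊕ shift (suc a ℕ.+ m) (B (suc a) r ⊛ (W (suc a) r ⊛ oneMinusQ (suc r)))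
        ≈⟨ ⊕-cong {f = shift E (P ⊛ oneMinusQ (suc a))} ≗-refl
                  (shift-cong (suc a ℕ.+ m) (extend (B (suc a) r) (W (suc a) r) (r ℕ.* m) (qFact (suc a ℕ.+ r))
                                                    (suc r) (qBinomial (suc a) r))) ⟩
      shift E (P ⊛ oneMinusQ (suc a)) ⊕ shift (suc a ℕ.+ m) (shift (r ℕ.* m) Q)
        ≈⟨ ⊕-cong {f = shift E (P ⊛ oneMinusQ (suc a))} ≗-refl
                  (≗-trans (shift-+ (suc a ℕ.+ m) (r ℕ.* m) Q) (shift-≡ Q (exponent a r))) ⟩
      shift E (P ⊛ oneMinusQ (suc a)) ⊕ shift (E ℕ.+ suc a) Q
        ≡⟨ cong (λ j → shift E (P ⊛ oneMinusQ (suc a)) ⊕ shift (E ℕ.+ suc a) (qFact j ⊛ oneMinusQ (suc r)))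
                (ℕ.+-suc a r) ⟨
      shift E (P ⊛ oneMinusQ (suc a)) ⊕ shift (E ℕ.+ suc a) (P ⊛ oneMinusQ (suc r))
        ≈⟨ ⊕-cong {f = shift E (P ⊛ oneMinusQ (suc a))} ≗-refl (shift-+ E (suc a) (P ⊛ oneMinusQ (suc r))) ⟨
      shift E (P ⊛ oneMinusQ (suc a)) ⊕ shift E (shift (suc a) (P ⊛ oneMinusQ (suc r)))
        ≈⟨ shift-⊕ E (P ⊛ oneMinusQ (suc a)) (shift (suc a) (P ⊛ oneMinusQ (suc r))) ⟨
      shift E (P ⊛ oneMinusQ (suc a) ⊕ shift (suc a) (P ⊛ oneMinusQ (suc r)))
        ≈⟨ shift-cong E (⊛-oneMinusQ-+ P (suc a) (suc r)) ⟩
      shift E (P ⊛ oneMinusQ (suc a ℕ.+ suc r))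
        ≈⟨ shift-cong E (qFact-sucʳ (a ℕ.+ suc r)) ⟨
      shift E (qFact (suc a ℕ.+ suc r))
        ∎
      where
      open ≗-Reasoning
      E : ℕ
      E = suc r ℕ.* m
      P Q : Series
      P = qFact (a ℕ.+ suc r)
      Q = qFact (suc a ℕ.+ r) ⊛ oneMinusQ (suc r)
      exponent : ∀ a r → suc a ℕ.+ m ℕ.+ r ℕ.* m ≡ m ℕ.+ r ℕ.* m ℕ.+ suc a
      exponent a r = reorder a r m
        where
        reorder : ∀ x y z → 1 ℕ.+ x ℕ.+ z ℕ.+ y ℕ.* z ≡ z ℕ.+ y ℕ.* z ℕ.+ (1 ℕ.+ x)
        reorder = ℕ-solve-∀

open PowerSeries

module Partitions where

  open import Data.Nat using (zero; _+_; _∸_; _<_; _≥_; _≤?_; _≟_; z≤n; s≤s)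
  import Data.Nat.Properties as ℕ
  open import Data.List using ([]; _∷_; _++_; length; filter; upTo; applyUpTo)
  import Data.List.Properties as List
  open import Data.List.Membership.Propositional.Properties
    using (∈-++⁻; ∈-++⁺ˡ; ∈-++⁺ʳ; ∈-map⁻; ∈-map⁺)
  open import Data.List.Membership.Propositional.Properties.WithK using (unique∧set⇒bag)
  open import Data.List.Relation.Binary.BagAndSetEquality using (∼bag⇒↭)
  open import Data.List.Relation.Binary.Permutation.Propositional.Properties using (map⁺)
  open import Data.List.Relation.Unary.Any using (here)
  open import Data.List.Relation.Unary.All as All using (All; []; _∷_)
  open import Data.List.Relation.Unary.Linked using (Linked; []; [-]; _∷_)
  open import Data.List.Relation.Unary.AllPairs using ([]; _∷_)
  import Data.List.Relation.Unary.Unique.Propositional.Properties as Unique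
  open import Data.Nat.ListAction.Properties using (sum-↭; sum-++)
  import Data.Integer as ℤ
  import Data.Integer.Properties as ℤ
  open import Data.Integer.Tactic.RingSolver using (solve-∀)
  open import Algebra.Properties.CommutativeSemigroup ℕ.+-commutativeSemigroup
    using () renaming (interchange to +-interchange)
  open import Function using (_∘_)
  open import Data.Bool using (true; false; if_then_else_)
  open import Data.Empty using (⊥-elim)
  open import Data.Product using (proj₁; proj₂)
  open import Data.Sum using (inj₁; inj₂)
  open import Relation.Nullary using (¬_; Dec; yes; no; does)
  open import Relation.Nullary.Decidable using (_×-dec_; does-⇔)
  open import Function.Bundles using (mk⇔)

  data BoundedPartition : ℕ → ℕ → List ℕ → Set where
    []   : ∀ {M} → BoundedPartition 0 M []
    cons : ∀ {M n x p} → 1 ≤ x → x ≤ M → BoundedPartition n x p → BoundedPartition (x + n) M (x ∷ p)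

  BoundedPartition-weaken : ∀ {n M M′ p} → M ≤ M′ → BoundedPartition n M p → BoundedPartition n M′ p
  BoundedPartition-weaken M≤M′ []                = []
  BoundedPartition-weaken M≤M′ (cons 1≤x x≤M bp) = cons 1≤x (ℕ.≤-trans x≤M M≤M′) bp

  BoundedPartition⇒All≤ : ∀ {n M p} → BoundedPartition n M p → All (_≤ M) p
  BoundedPartition⇒All≤ []              = []
  BoundedPartition⇒All≤ (cons _ x≤M bp) = x≤M ∷ All.map (λ y≤x → ℕ.≤-trans y≤x x≤M) (BoundedPartition⇒All≤ bp)

  BoundedPartition⇒IsPartitionOf : ∀ {n M p} → BoundedPartition n M p → IsPartitionOf n p
  BoundedPartition⇒IsPartitionOf bp = linked bp , positive bp , total bp
    where
    linked : ∀ {n M p} → BoundedPartition n M p → Linked _≥_ p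
    linked []                           = []
    linked (cons _ _ [])                = [-]
    linked (cons _ _ bp@(cons _ y≤x _)) = y≤x ∷ linked bp
    positive : ∀ {n M p} → BoundedPartition n M p → All (1 ≤_) p
    positive []              = []
    positive (cons 1≤x _ bp) = 1≤x ∷ positive bp
    total : ∀ {n M p} → BoundedPartition n M p → sum p ≡ n
    total []                    = refl
    total (cons {x = x} _ _ bp) = cong (_+_ x) (total bp)

  IsPartitionOf⇒BoundedPartition : ∀ {n p} → IsPartitionOf n p → BoundedPartition n n p
  IsPartitionOf⇒BoundedPartition {p = []}    (_ , _ , refl)             = []
  IsPartitionOf⇒BoundedPartition {p = x ∷ p} (linked , positive , refl) =
    BoundedPartition-weaken (ℕ.m≤m+n x (sum p)) (headBounded linked positive)
    where
    headBounded : ∀ {x p} → Linked _≥_ (x ∷ p) → All (1 ≤_) (x ∷ p) → BoundedPartition (sum (x ∷ p)) x (x ∷ p)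
    headBounded [-]            (1≤x ∷ [])       = cons 1≤x ℕ.≤-refl []
    headBounded (y≤x ∷ linked) (1≤x ∷ positive) =
      cons 1≤x ℕ.≤-refl (BoundedPartition-weaken y≤x (headBounded linked positive))

  -- Partitions of n into parts ≤ M; any fuel exceeding n suffices, as every recursive call lowers n.
  partitionsWithFuel : ℕ → ℕ → ℕ → List (List ℕ)
  partitionsWithFuel zero    n M       = []
  partitionsWithFuel (suc f) n zero    = if does (n ≟ 0) then [] ∷ [] else []
  partitionsWithFuel (suc f) n (suc M) =
    partitionsWithFuel (suc f) n M ++
    (if does (suc M ≤? n) then map (suc M ∷_) (partitionsWithFuel f (n ∸ suc M) (suc M)) else [])

  partitions : ℕ → ℕ → List (List ℕ)
  partitions n M = partitionsWithFuel (suc n) n M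

  module _ {P : Set} {A : Set} where

    ∈-if⁻ : ∀ (d : Dec P) {xs : List A} {x} → x ∈ (if does d then xs else []) → P × x ∈ xs
    ∈-if⁻ (yes p) x∈xs = p , x∈xs

    ∈-if⁺ : ∀ (d : Dec P) {xs : List A} {x} → P → x ∈ xs → x ∈ (if does d then xs else [])
    ∈-if⁺ (yes _) _ x∈xs = x∈xs
    ∈-if⁺ (no ¬p) p _    = ⊥-elim (¬p p)

    if-cong : ∀ (d : Dec P) {xs ys zs : List A} → (P → xs ≡ ys) →
              (if does d then xs else zs) ≡ (if does d then ys else zs)
    if-cong (yes p) xs≡ys = xs≡ys p
    if-cong (no _)  _     = refl

    Unique-if : ∀ (d : Dec P) {xs : List A} → Unique xs → Unique (if does d then xs else [])
    Unique-if (yes _) u = u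
    Unique-if (no _)  _ = []

  ∸-suc-< : ∀ {M n} → suc M ≤ n → n ∸ suc M < n
  ∸-suc-< {M} {suc n} (s≤s M≤n) = s≤s (ℕ.m∸n≤m n M)

  partitionsWithFuel-fuel : ∀ {f g n} M → n < f → n < g → partitionsWithFuel f n M ≡ partitionsWithFuel g n M
  partitionsWithFuel-fuel {suc f} {suc g}     zero    _   _   = refl
  partitionsWithFuel-fuel {suc f} {suc g} {n} (suc M) n<f n<g =
    cong₂ _++_ (partitionsWithFuel-fuel M n<f n<g) (if-cong (suc M ≤? n) λ 1+M≤n →
      cong (map (suc M ∷_)) (partitionsWithFuel-fuel (suc M)
        (ℕ.<-≤-trans (∸-suc-< 1+M≤n) (ℕ.≤-pred n<f)) (ℕ.<-≤-trans (∸-suc-< 1+M≤n) (ℕ.≤-pred n<g))))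

  partitions-suc : ∀ n M → partitions n (suc M) ≡
    partitions n M ++ (if does (suc M ≤? n) then map (suc M ∷_) (partitions (n ∸ suc M) (suc M)) else [])
  partitions-suc n M = cong (partitions n M ++_) (if-cong (suc M ≤? n) λ 1+M≤n →
    cong (map (suc M ∷_)) (partitionsWithFuel-fuel (suc M) (∸-suc-< 1+M≤n) ℕ.≤-refl))

  ∈-partitionsWithFuel⁻ : ∀ f n M {p} → p ∈ partitionsWithFuel f n M → BoundedPartition n M p
  ∈-partitionsWithFuel⁻ (suc f) n zero    p∈ with ∈-if⁻ (n ≟ 0) p∈
  ... | refl , here refl = []
  ∈-partitionsWithFuel⁻ (suc f) n (suc M) p∈ with ∈-++⁻ (partitionsWithFuel (suc f) n M) p∈
  ... | inj₁ p∈ˡ = BoundedPartition-weaken (ℕ.n≤1+n M) (∈-partitionsWithFuel⁻ (suc f) n M p∈ˡ)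
  ... | inj₂ p∈ʳ with ∈-if⁻ (suc M ≤? n) p∈ʳ
  ...   | 1+M≤n , p∈map with ∈-map⁻ (suc M ∷_) p∈map
  ...     | q , q∈ , refl = subst (λ n′ → BoundedPartition n′ (suc M) (suc M ∷ q)) (ℕ.m+[n∸m]≡n 1+M≤n)
                              (cons (s≤s z≤n) ℕ.≤-refl (∈-partitionsWithFuel⁻ f (n ∸ suc M) (suc M) q∈))

  ∈-partitionsWithFuel⁺ : ∀ {f n M p} → BoundedPartition n M p → n < f → p ∈ partitionsWithFuel f n M
  ∈-partitionsWithFuel⁺ {suc f} {M = zero}  []                 _ = ∈-if⁺ (0 ≟ 0) refl (here refl)
  ∈-partitionsWithFuel⁺ {suc f} {M = suc M} []                 0<f = ∈-++⁺ˡ (∈-partitionsWithFuel⁺ {M = M} [] 0<f)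
  ∈-partitionsWithFuel⁺ {suc f} {M = zero}  (cons 1≤x x≤0 _)   _ = ⊥-elim (ℕ.<⇒≱ 1≤x x≤0)
  ∈-partitionsWithFuel⁺ {suc f} {M = suc M} (cons {n = n} {x} 1≤x x≤1+M bp) x+n<f with ℕ.m≤n⇒m<n∨m≡n x≤1+M
  ... | inj₁ x<1+M = ∈-++⁺ˡ (∈-partitionsWithFuel⁺ (cons 1≤x (ℕ.≤-pred x<1+M) bp) x+n<f)
  ... | inj₂ refl  = ∈-++⁺ʳ (partitionsWithFuel (suc f) (suc M + n) M)
    (∈-if⁺ (suc M ≤? suc M + n) (ℕ.m≤m+n (suc M) n) (∈-map⁺ (suc M ∷_)
      (subst (λ n′ → _ ∈ partitionsWithFuel f n′ (suc M)) (sym (ℕ.m+n∸m≡n (suc M) n))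
        (∈-partitionsWithFuel⁺ bp (ℕ.≤-trans (s≤s (ℕ.m≤n+m n M)) (ℕ.≤-pred x+n<f))))))

  partitionsWithFuel-unique : ∀ f n M → Unique (partitionsWithFuel f n M)
  partitionsWithFuel-unique zero    n zero    = []
  partitionsWithFuel-unique zero    n (suc M) = []
  partitionsWithFuel-unique (suc f) n zero    = Unique-if (n ≟ 0) ([] ∷ [])
  partitionsWithFuel-unique (suc f) n (suc M) = Unique.++⁺ (partitionsWithFuel-unique (suc f) n M)
    (Unique-if (suc M ≤? n) (Unique.map⁺ List.∷-injectiveʳ (partitionsWithFuel-unique f (n ∸ suc M) (suc M))))
    disjoint
    where
    disjoint : ∀ {p} → ¬ (p ∈ partitionsWithFuel (suc f) n M × p ∈
      (if does (suc M ≤? n) then map (suc M ∷_) (partitionsWithFuel f (n ∸ suc M) (suc M)) else []))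
    disjoint (p∈ˡ , p∈ʳ) with ∈-map⁻ (suc M ∷_) (proj₂ (∈-if⁻ (suc M ≤? n) p∈ʳ))
    ... | _ , _ , refl with ∈-partitionsWithFuel⁻ (suc f) n M p∈ˡ
    ...   | cons _ 1+M≤M _ = ℕ.<-irrefl refl 1+M≤M

  sum-over-partitions : ∀ (g : List ℕ → ℕ) {n N} → n ≤ N → (L : List (List ℕ)) → Unique L →
    (∀ p → (p ∈ L → IsPartitionOf n p) × (IsPartitionOf n p → p ∈ L)) →
    sum (map g L) ≡ sum (map g (partitions n N))
  sum-over-partitions g {n} {N} n≤N L unique-L L-spec =
    sum-↭ (map⁺ g (∼bag⇒↭ (unique∧set⇒bag unique-L (partitionsWithFuel-unique (suc n) n N) (mk⇔ to from))))
    where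
    to : ∀ {p} → p ∈ L → p ∈ partitions n N
    to {p} p∈L = ∈-partitionsWithFuel⁺
      (BoundedPartition-weaken n≤N (IsPartitionOf⇒BoundedPartition (proj₁ (L-spec p) p∈L))) ℕ.≤-refl
    from : ∀ {p} → p ∈ partitions n N → p ∈ L
    from {p} p∈ = proj₂ (L-spec p) (BoundedPartition⇒IsPartitionOf (∈-partitionsWithFuel⁻ (suc n) n N p∈))

  gf : (List ℕ → ℕ) → ℕ → Series
  gf g M n = + sum (map g (partitions n M))

  gf-cong : ∀ {g h} M → (∀ {n p} → BoundedPartition n M p → g p ≡ h p) → gf g M ≗ gf h M
  gf-cong {g} {h} M g≡h n = cong (λ xs → + sum xs)
    (List.map-cong-local (All.tabulate (λ p∈ → g≡h (∈-partitionsWithFuel⁻ (suc n) n M p∈))))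

  gf-+ : ∀ g h M → gf (λ p → g p + h p) M ≗ gf g M ⊕ gf h M
  gf-+ g h M n = trans (cong +_ (sum-map-+ (partitions n M))) (ℤ.pos-+ (sum (map g (partitions n M))) _)
    where
    sum-map-+ : ∀ ps → sum (map (λ p → g p + h p) ps) ≡ sum (map g ps) + sum (map h ps)
    sum-map-+ []       = refl
    sum-map-+ (p ∷ ps) = trans (cong (_+_ (g p + h p)) (sum-map-+ ps)) (+-interchange (g p) (h p) _ _)

  gf-vanish : ∀ {g} M → (∀ {n p} → BoundedPartition n M p → g p ≡ 0) → gf g M ≗ 𝟘
  gf-vanish M g≡0 n = trans (gf-cong M g≡0 n) (cong +_ (sum-map-0 (partitions n M)))
    where
    sum-map-0 : ∀ (ps : List (List ℕ)) → sum (map (λ _ → 0) ps) ≡ 0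
    sum-map-0 []       = refl
    sum-map-0 (_ ∷ ps) = sum-map-0 ps

  gf-const-zero : gf (λ _ → 1) 0 ≗ one
  gf-const-zero n with does (n ≟ 0)
  ... | true  = refl
  ... | false = refl

  gf-suc : ∀ g M → gf g (suc M) ≗ gf g M ⊕ shift (suc M) (gf (g ∘ (suc M ∷_)) (suc M))
  gf-suc g M n = begin
    + sum (map g (partitions n (suc M)))
      ≡⟨ cong (λ ps → + sum (map g ps)) (partitions-suc n M) ⟩
    + sum (map g (partitions n M ++ largest))
      ≡⟨ cong (λ ps → + sum ps) (List.map-++ g (partitions n M) largest) ⟩
    + sum (map g (partitions n M) ++ map g largest)
      ≡⟨ cong +_ (sum-++ (map g (partitions n M)) _) ⟩
    + (sum (map g (partitions n M)) + sum (map g largest))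
      ≡⟨ ℤ.pos-+ (sum (map g (partitions n M))) _ ⟩
    gf g M n ℤ.+ + sum (map g largest)
      ≡⟨ cong (ℤ._+_ (gf g M n)) (sum-map-if (does (suc M ≤? n))) ⟩
    gf g M n ℤ.+ shift (suc M) (gf (g ∘ (suc M ∷_)) (suc M)) n
      ∎
    where
    open ≡-Reasoning
    tails largest : List (List ℕ)
    tails = partitions (n ∸ suc M) (suc M)
    largest = if does (suc M ≤? n) then map (suc M ∷_) tails else []
    sum-map-if : ∀ b → + sum (map g (if b then map (suc M ∷_) tails else []))
                     ≡ (if b then + sum (map (g ∘ (suc M ∷_)) tails) else + 0)
    sum-map-if true  = cong (λ ps → + sum ps) (sym (List.map-∘ tails))
    sum-map-if false = refl

  gf-suc-oneMinusQ : ∀ {g} h M → (∀ {n p} → BoundedPartition n (suc M) p → g (suc M ∷ p) ≡ h p + g p) →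
                     gf g (suc M) ⊛ oneMinusQ (suc M) ≗ gf g M ⊕ shift (suc M) (gf h (suc M))
  gf-suc-oneMinusQ {g} h M peel n = begin
    (gf g (suc M) ⊛ oneMinusQ (suc M)) n                          ≡⟨ ⊛-oneMinusQ (gf g (suc M)) (suc M) n ⟩
    gf g (suc M) n ℤ.- S                                          ≡⟨ cong (ℤ._- S) (gf-suc g M n) ⟩
    gf g M n ℤ.+ shift (suc M) (gf (g ∘ (suc M ∷_)) (suc M)) n ℤ.- S
      ≡⟨ cong (λ x → gf g M n ℤ.+ x ℤ.- S)
              (shift-cong (suc M) (≗-trans (gf-cong (suc M) peel) (gf-+ h g (suc M))) n) ⟩
    gf g M n ℤ.+ shift (suc M) (gf h (suc M) ⊕ gf g (suc M)) n ℤ.- S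
      ≡⟨ cong (λ x → gf g M n ℤ.+ x ℤ.- S) (shift-⊕ (suc M) (gf h (suc M)) (gf g (suc M)) n) ⟩
    gf g M n ℤ.+ (shift (suc M) (gf h (suc M)) n ℤ.+ S) ℤ.- S
      ≡⟨ cancel (gf g M n) (shift (suc M) (gf h (suc M)) n) S ⟩
    gf g M n ℤ.+ shift (suc M) (gf h (suc M)) n
      ∎
    where
    open ≡-Reasoning
    S : ℤ.ℤ
    S = shift (suc M) (gf g (suc M)) n
    cancel : ∀ a x s → a ℤ.+ (x ℤ.+ s) ℤ.- s ≡ a ℤ.+ x
    cancel = solve-∀

  𝟙 : ∀ {P : Set} → Dec P → ℕ
  𝟙 d = if does d then 1 else 0

  length-filter-∷ : ∀ {A : Set} {P : A → Set} (P? : ∀ x → Dec (P x)) x xs →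
                    length (filter P? (x ∷ xs)) ≡ 𝟙 (P? x) + length (filter P? xs)
  length-filter-∷ P? x xs with does (P? x)
  ... | true  = refl
  ... | false = refl

  length-filter-map : ∀ {A B : Set} {P : A → Set} {Q : B → Set} (P? : ∀ x → Dec (P x)) (Q? : ∀ y → Dec (Q y))
                      {f : ℕ → A} {g : ℕ → B} xs → (∀ i → does (P? (f i)) ≡ does (Q? (g i))) →
                      length (filter P? (map f xs)) ≡ length (filter Q? (map g xs))
  length-filter-map P? Q?         []       _    = refl
  length-filter-map P? Q? {f} {g} (x ∷ xs) same = begin
    length (filter P? (map f (x ∷ xs)))             ≡⟨ length-filter-∷ P? (f x) (map f xs) ⟩
    𝟙 (P? (f x)) + length (filter P? (map f xs))    ≡⟨ cong₂ _+_ (cong (λ b → if b then 1 else 0) (same x))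
                                                                 (length-filter-map P? Q? xs same) ⟩
    𝟙 (Q? (g x)) + length (filter Q? (map g xs))    ≡⟨ length-filter-∷ Q? (g x) (map g xs) ⟨
    length (filter Q? (map g (x ∷ xs)))             ∎
    where open ≡-Reasoning

  part-≤ : ∀ {M p} → All (_≤ M) p → ∀ i → part p i ≤ M
  part-≤ []        _             = z≤n
  part-≤ (_ ∷ _)   zero          = z≤n
  part-≤ (x≤M ∷ _) (suc zero)    = x≤M
  part-≤ (_ ∷ ≤M)  (suc (suc i)) = part-≤ ≤M (suc i)

  conj-∷ : ∀ {m x} p → m ≤ x → conj (x ∷ p) m ≡ suc (conj p m)
  conj-∷ {m} p m≤x = cong length (List.filter-accept (m ≤?_) m≤x)

  conj-< : ∀ {m M p} → All (_≤ M) p → M < m → conj p m ≡ 0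
  conj-< {m} ≤M M<m =
    cong length (List.filter-none (m ≤?_) (All.map (λ x≤M → ℕ.<⇒≱ (ℕ.≤-<-trans x≤M M<m)) ≤M))

  module _ {m x : ℕ} (p : List ℕ) (m≤x : m ≤ x) where

    hook-head : hook (x ∷ p) 1 m ≡ x ∸ m + suc (conj p m)
    hook-head = begin
      (x + conj (x ∷ p) m + 1) ∸ suc m    ≡⟨ cong (λ c → (x + c + 1) ∸ suc m) (conj-∷ p m≤x) ⟩
      (x + suc (conj p m) + 1) ∸ suc m    ≡⟨ cong (_∸ suc m) (ℕ.+-comm _ 1) ⟩
      (x + suc (conj p m)) ∸ m            ≡⟨ ℕ.+-∸-comm (suc (conj p m)) m≤x ⟩
      x ∸ m + suc (conj p m)              ∎
      where open ≡-Reasoning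

    hook-tail : ∀ i → hook (x ∷ p) (suc (suc i)) m ≡ hook p (suc i) m
    hook-tail i = begin
      (part p (suc i) + conj (x ∷ p) m + 1) ∸ (2 + i + m)    ≡⟨ cong (λ c → (part p (suc i) + c + 1) ∸ (2 + i + m))
                                                                     (conj-∷ p m≤x) ⟩
      (part p (suc i) + suc (conj p m) + 1) ∸ (2 + i + m)    ≡⟨ cong (λ y → (y + 1) ∸ (2 + i + m))
                                                                     (ℕ.+-suc (part p (suc i)) (conj p m)) ⟩
      (part p (suc i) + conj p m + 1) ∸ (1 + i + m)          ∎
      where open ≡-Reasoning

  module _ (m k : ℕ) where

    private
      HookCell? : ∀ p i → Dec (m ≤ part p i × hook p i m ≡ k)
      HookCell? p i = (m ≤? part p i) ×-dec (hook p i m ≟ k)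

    colHooks-∷ : ∀ {x} p → m ≤ x → colHooks m k (x ∷ p) ≡ 𝟙 (x ∸ m + suc (conj p m) ≟ k) + colHooks m k p
    colHooks-∷ {x} p m≤x = begin
      length (filter (HookCell? (x ∷ p)) (1 ∷ map suc (applyUpTo suc (length p))))
        ≡⟨ length-filter-∷ (HookCell? (x ∷ p)) 1 _ ⟩
      𝟙 (HookCell? (x ∷ p) 1) + length (filter (HookCell? (x ∷ p)) (map suc (applyUpTo suc (length p))))
        ≡⟨ cong₂ _+_ (cong (λ b → if b then 1 else 0) head)
                     (cong (λ is → length (filter (HookCell? (x ∷ p)) is)) indices) ⟩
      𝟙 (x ∸ m + suc (conj p m) ≟ k) + length (filter (HookCell? (x ∷ p)) (map (suc ∘ suc) (upTo (length p))))
        ≡⟨ cong (_+_ (𝟙 (x ∸ m + suc (conj p m) ≟ k)))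
                (length-filter-map (HookCell? (x ∷ p)) (HookCell? p) (upTo (length p))
                  λ i → cong (λ h → does ((m ≤? part p (suc i)) ×-dec (h ≟ k))) (hook-tail p m≤x i)) ⟩
      𝟙 (x ∸ m + suc (conj p m) ≟ k) + colHooks m k p
        ∎
      where
      open ≡-Reasoning
      head : does (HookCell? (x ∷ p) 1) ≡ does (x ∸ m + suc (conj p m) ≟ k)
      head = does-⇔ (mk⇔ (λ (_ , hook≡k) → trans (sym (hook-head p m≤x)) hook≡k)
                         (λ eq → m≤x , trans (hook-head p m≤x) eq))
                    (HookCell? (x ∷ p) 1) (x ∸ m + suc (conj p m) ≟ k)
      indices : map suc (applyUpTo suc (length p)) ≡ map (suc ∘ suc) (upTo (length p))
      indices = trans (List.map-applyUpTo suc suc (length p)) (sym (List.map-upTo (suc ∘ suc) (length p)))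

    colHooks-< : ∀ {M p} → All (_≤ M) p → M < m → colHooks m k p ≡ 0
    colHooks-< {p = p} ≤M M<m = cong length (List.filter-none (HookCell? p)
      (All.tabulate {xs = map suc (upTo (length p))} λ {i} _ (m≤part , _) →
        ℕ.<⇒≱ (ℕ.≤-<-trans (part-≤ ≤M i) M<m) m≤part))

  partitionGF-qFact : ∀ M → gf (λ _ → 1) M ⊛ qFact M ≗ one
  partitionGF-qFact zero    = ≗-trans (⊛-identityʳ (gf (λ _ → 1) 0)) gf-const-zero
  partitionGF-qFact (suc M) = begin
    gf (λ _ → 1) (suc M) ⊛ qFact (suc M)                      ≈⟨ ⊛-congˡ (gf (λ _ → 1) (suc M)) (qFact-sucʳ M) ⟩
    gf (λ _ → 1) (suc M) ⊛ (qFact M ⊛ oneMinusQ (suc M))      ≈⟨ x∙yz≈xz∙y (gf (λ _ → 1) (suc M)) (qFact M) _ ⟩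
    (gf (λ _ → 1) (suc M) ⊛ oneMinusQ (suc M)) ⊛ qFact M      ≈⟨ ⊛-congʳ (qFact M) peeled ⟩
    gf (λ _ → 1) M ⊛ qFact M                                  ≈⟨ partitionGF-qFact M ⟩
    one                                                       ∎
    where
    open ≗-Reasoning
    peeled : gf (λ _ → 1) (suc M) ⊛ oneMinusQ (suc M) ≗ gf (λ _ → 1) M
    peeled = begin
      gf (λ _ → 1) (suc M) ⊛ oneMinusQ (suc M)               ≈⟨ gf-suc-oneMinusQ (λ _ → 0) M (λ _ → refl) ⟩
      gf (λ _ → 1) M ⊕ shift (suc M) (gf (λ _ → 0) (suc M))  ≈⟨ ⊕-cong {f = gf (λ _ → 1) M} ≗-refl
        (≗-trans (shift-cong (suc M) (gf-vanish (suc M) (λ _ → refl))) (shift-𝟘 (suc M))) ⟩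
      gf (λ _ → 1) M ⊕ 𝟘                                     ≈⟨ (λ n → ℤ.+-identityʳ (gf (λ _ → 1) M n)) ⟩
      gf (λ _ → 1) M                                         ∎

open Partitions

module LargeParts (m′ : ℕ) where

  open import Data.Nat using (_+_; _*_; _<_; _≟_)
  import Data.Nat.Properties as ℕ
  import Data.Integer as ℤ
  import Data.Integer.Properties as ℤ
  open import Data.List using (_∷_)

  m : ℕ
  m = suc m′

  largePartsGF : ℕ → ℕ → Series
  largePartsGF r = gf (λ p → 𝟙 (conj p m ≟ r))

  largePartsGF-<-zero : ∀ {M} → M < m → largePartsGF 0 M ≗ gf (λ _ → 1) M
  largePartsGF-<-zero M<m =
    gf-cong _ (λ bp → cong (λ c → 𝟙 (c ≟ 0)) (conj-< (BoundedPartition⇒All≤ bp) M<m))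

  largePartsGF-<-suc : ∀ {M} r → M < m → largePartsGF (suc r) M ≗ 𝟘
  largePartsGF-<-suc r M<m =
    gf-vanish _ (λ bp → cong (λ c → 𝟙 (c ≟ suc r)) (conj-< (BoundedPartition⇒All≤ bp) M<m))

  largePartsGF-suc-zero : ∀ {M} → m ≤ suc M → largePartsGF 0 (suc M) ≗ largePartsGF 0 M
  largePartsGF-suc-zero {M} m≤1+M = begin
    largePartsGF 0 (suc M)
      ≈⟨ gf-suc (λ p → 𝟙 (conj p m ≟ 0)) M ⟩
    largePartsGF 0 M ⊕ shift (suc M) (gf (λ p → 𝟙 (conj (suc M ∷ p) m ≟ 0)) (suc M))
      ≈⟨ ⊕-cong {f = largePartsGF 0 M} ≗-refl (≗-trans (shift-cong (suc M)
           (gf-vanish (suc M) λ {_} {p} _ → cong (λ c → 𝟙 (c ≟ 0)) (conj-∷ p m≤1+M))) (shift-𝟘 (suc M))) ⟩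
    largePartsGF 0 M ⊕ 𝟘
      ≈⟨ (λ n → ℤ.+-identityʳ (largePartsGF 0 M n)) ⟩
    largePartsGF 0 M
      ∎
    where open ≗-Reasoning

  largePartsGF-suc-suc : ∀ {M} r → m ≤ suc M →
    largePartsGF (suc r) (suc M) ≗ largePartsGF (suc r) M ⊕ shift (suc M) (largePartsGF r (suc M))
  largePartsGF-suc-suc {M} r m≤1+M = ≗-trans (gf-suc (λ p → 𝟙 (conj p m ≟ suc r)) M)
    (⊕-cong {f = largePartsGF (suc r) M} ≗-refl (shift-cong (suc M)
      (gf-cong (suc M) λ {_} {p} _ → cong (λ c → 𝟙 (c ≟ suc r)) (conj-∷ p m≤1+M))))

  largePartsGF-qBinomial : ∀ a r →
    (largePartsGF r (a + m) ⊛ qFact m′) ⊛ (qFact a ⊛ qFact r) ≗ shift (r * m) (qFact (a + r))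
  largePartsGF-qBinomial = QBinomial.qBinomial m B B-zero-zero B-zero-suc B-suc-zero B-suc-suc
    where
    open ≗-Reasoning
    B : ℕ → ℕ → Series
    B a r = largePartsGF r (a + m) ⊛ qFact m′
    m′<m : m′ < m
    m′<m = ℕ.≤-refl
    B-zero-zero : B 0 0 ≗ one
    B-zero-zero = begin
      largePartsGF 0 m ⊛ qFact m′     ≈⟨ ⊛-congʳ (qFact m′) (largePartsGF-suc-zero ℕ.≤-refl) ⟩
      largePartsGF 0 m′ ⊛ qFact m′    ≈⟨ ⊛-congʳ (qFact m′) (largePartsGF-<-zero m′<m) ⟩
      gf (λ _ → 1) m′ ⊛ qFact m′      ≈⟨ partitionGF-qFact m′ ⟩
      one                             ∎
    B-zero-suc : ∀ r → B 0 (suc r) ≗ shift m (B 0 r)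
    B-zero-suc r = begin
      largePartsGF (suc r) m ⊛ qFact m′
        ≈⟨ ⊛-congʳ (qFact m′) (largePartsGF-suc-suc r ℕ.≤-refl) ⟩
      (largePartsGF (suc r) m′ ⊕ shift m (largePartsGF r m)) ⊛ qFact m′
        ≈⟨ ⊛-congʳ (qFact m′) (λ n → trans (cong (ℤ._+ shift m (largePartsGF r m) n) (largePartsGF-<-suc r m′<m n))
                                           (ℤ.+-identityˡ (shift m (largePartsGF r m) n))) ⟩
      shift m (largePartsGF r m) ⊛ qFact m′
        ≈⟨ shift-⊛ m (largePartsGF r m) (qFact m′) ⟩
      shift m (largePartsGF r m ⊛ qFact m′)
        ∎
    B-suc-zero : ∀ a → B (suc a) 0 ≗ B a 0
    B-suc-zero a = ⊛-congʳ (qFact m′) (largePartsGF-suc-zero (ℕ.m≤n+m m (suc a)))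
    B-suc-suc : ∀ a r → B (suc a) (suc r) ≗ B a (suc r) ⊕ shift (suc a + m) (B (suc a) r)
    B-suc-suc a r = begin
      largePartsGF (suc r) (suc a + m) ⊛ qFact m′
        ≈⟨ ⊛-congʳ (qFact m′) (largePartsGF-suc-suc r (ℕ.m≤n+m m (suc a))) ⟩
      (largePartsGF (suc r) (a + m) ⊕ shift (suc a + m) (largePartsGF r (suc a + m))) ⊛ qFact m′
        ≈⟨ ⊛-distribʳ-⊕ (largePartsGF (suc r) (a + m)) (shift (suc a + m) (largePartsGF r (suc a + m))) (qFact m′) ⟩
      B a (suc r) ⊕ shift (suc a + m) (largePartsGF r (suc a + m)) ⊛ qFact m′
        ≈⟨ ⊕-cong {f = B a (suc r)} ≗-refl (shift-⊛ (suc a + m) (largePartsGF r (suc a + m)) (qFact m′)) ⟩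
      B a (suc r) ⊕ shift (suc a + m) (B (suc a) r)
        ∎

module HookSeries (m′ k′ : ℕ) where

  open import Data.Nat using (_+_; _*_; _∸_; _<_; _≟_; z≤n; s≤s)
  import Data.Nat.Properties as ℕ
  open import Data.Nat.Tactic.RingSolver using (solve-∀)
  open import Data.List using (upTo)
  import Data.List.Properties as List
  open import Data.Bool using (if_then_else_)
  open import Relation.Nullary.Decidable using (dec-false; does-⇔)
  open import Function using (_∘_)
  open import Function.Bundles using (mk⇔)
  open LargeParts m′

  k : ℕ
  k = suc k′

  hooksGF : ℕ → Series
  hooksGF = gf (colHooks m k)

  -- Weights each partition by whether a new first row of length m + t on top of it has a
  -- column-m hook of size k (arm t, leg the number of parts ≥ m).
  topHookGF : ℕ → Series
  topHookGF t = gf (λ p → 𝟙 (t + suc (conj p m) ≟ k)) (m + t)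

  hooksGF-< : ∀ {M} → M < m → hooksGF M ≗ 𝟘
  hooksGF-< M<m = gf-vanish _ (λ bp → colHooks-< m k (BoundedPartition⇒All≤ bp) M<m)

  hooksGF-suc : ∀ t → hooksGF (m + t) ⊛ oneMinusQ (m + t) ≗ hooksGF (m′ + t) ⊕ shift (m + t) (topHookGF t)
  hooksGF-suc t = ≗-trans
    (gf-suc-oneMinusQ (λ p → 𝟙 ((m + t) ∸ m + suc (conj p m) ≟ k)) (m′ + t)
      (λ {_} {p} _ → colHooks-∷ m k p (ℕ.m≤m+n m t)))
    (⊕-cong {f = hooksGF (m′ + t)} ≗-refl (shift-cong (m + t) (gf-cong (m + t)
      (λ {_} {p} _ → cong (λ a → 𝟙 (a + suc (conj p m) ≟ k)) (ℕ.m+n∸m≡n m t)))))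

  topHookGF-≥ : ∀ {t} → k ≤ t → topHookGF t ≗ 𝟘
  topHookGF-≥ {t} k≤t = gf-vanish (m + t) (λ {_} {p} _ → cong (λ b → if b then 1 else 0)
    (dec-false (t + suc (conj p m) ≟ k) (λ eq → ℕ.<⇒≢ (ℕ.≤-<-trans k≤t (ℕ.m<m+n t (s≤s z≤n))) (sym eq))))

  topHookGF-< : ∀ {t} → t < k → topHookGF t ≗ largePartsGF (k ∸ suc t) (t + m)
  topHookGF-< {t} t<k = ≗-trans
    (gf-cong (m + t) (λ {_} {p} _ → cong (λ b → if b then 1 else 0)
      (does-⇔ (mk⇔ to from) (t + suc (conj p m) ≟ k) (conj p m ≟ k ∸ suc t))))
    (cong-app (cong (largePartsGF (k ∸ suc t)) (ℕ.+-comm m t)))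
    where
    to : ∀ {c} → t + suc c ≡ k → c ≡ k ∸ suc t
    to {c} eq = sym (trans (cong (_∸ suc t) (sym eq))
                           (trans (cong (_∸ suc t) (ℕ.+-suc t c)) (ℕ.m+n∸m≡n (suc t) c)))
    from : ∀ {c} → c ≡ k ∸ suc t → t + suc c ≡ k
    from refl = trans (ℕ.+-suc t (k ∸ suc t)) (ℕ.m+[n∸m]≡n t<k)

  term : ℕ → Series
  term a = shift (m + a) (topHookGF a ⊛ pochFin m a)

  hooksGF-telescope : ∀ t → hooksGF (m′ + t) ⊛ pochFin m t ≗ ∑ˢ t term
  hooksGF-telescope = telescope m (λ t → hooksGF (m′ + t)) topHookGF
    (hooksGF-< (s≤s (ℕ.≤-reflexive (ℕ.+-identityʳ m′))))
    (λ t → ≗-trans (⊛-congʳ (oneMinusQ (m + t)) (cong-app (cong hooksGF (ℕ.+-suc m′ t)))) (hooksGF-suc t))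

  term-≥ : ∀ {a} → k ≤ a → term a ≗ 𝟘
  term-≥ {a} k≤a = ≗-trans
    (shift-cong (m + a) (≗-trans (⊛-congʳ (pochFin m a) (topHookGF-≥ k≤a)) (⊛-zeroˡ (pochFin m a))))
    (shift-𝟘 (m + a))

  rhsTerm-exponent : ∀ a b → (suc a + b) * m ∸ a * m′ ≡ m + a + b * m
  rhsTerm-exponent a b = trans (cong (_∸ a * m′) (expand a b m′)) (ℕ.m+n∸n≡m (m + a + b * m) (a * m′))
    where
    expand : ∀ a b m′ → (1 + a + b) * (1 + m′) ≡ 1 + m′ + a + b * (1 + m′) + a * m′
    expand = solve-∀

  term-< : ∀ {a} → a < k → term a ⊛ qFact m′ ≗ rhsTerm m k (suc a) ⊛ qFact k′
  term-< {a} a<k = begin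
    shift (m + a) (topHookGF a ⊛ P) ⊛ qFact m′            ≈⟨ shift-⊛ (m + a) (topHookGF a ⊛ P) (qFact m′) ⟩
    shift (m + a) ((topHookGF a ⊛ P) ⊛ qFact m′)          ≈⟨ shift-cong (m + a) (xy∙z≈xz∙y (topHookGF a) P (qFact m′)) ⟩
    shift (m + a) ((topHookGF a ⊛ qFact m′) ⊛ P)          ≈⟨ shift-cong (m + a) (⊛-congʳ P quotient) ⟩
    shift (m + a) ((shift (b * m) (qFact k′) ⊛ I) ⊛ P)    ≈⟨ shift-cong (m + a) (≗-trans
                                                               (⊛-congʳ P (shift-⊛ (b * m) (qFact k′) I))
                                                               (shift-⊛ (b * m) (qFact k′ ⊛ I) P)) ⟩
    shift (m + a) (shift (b * m) ((qFact k′ ⊛ I) ⊛ P))    ≈⟨ shift-+ (m + a) (b * m) ((qFact k′ ⊛ I) ⊛ P) ⟩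
    shift (m + a + b * m) ((qFact k′ ⊛ I) ⊛ P)            ≈⟨ shift-≡ ((qFact k′ ⊛ I) ⊛ P) exponent ⟨
    shift E ((qFact k′ ⊛ I) ⊛ P)                          ≈⟨ shift-cong E (xy∙z≈zy∙x P I (qFact k′)) ⟨
    shift E ((P ⊛ I) ⊛ qFact k′)                          ≈⟨ shift-⊛ E (P ⊛ I) (qFact k′) ⟨
    shift E (P ⊛ I) ⊛ qFact k′                            ∎
    where
    open ≗-Reasoning
    b E : ℕ
    b = k ∸ suc a
    E = k * m ∸ a * m′
    P I : Series
    P = pochFin m a
    I = inv (qFact a) ⊛ inv (qFact b)
    1+a+b≡k : suc a + b ≡ k
    1+a+b≡k = ℕ.m+[n∸m]≡n a<k
    quotient : topHookGF a ⊛ qFact m′ ≗ shift (b * m) (qFact k′) ⊛ I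
    quotient = ⊛-divide (qFact a) (qFact b) (qFact-constant a) (qFact-constant b) (begin
      (topHookGF a ⊛ qFact m′) ⊛ (qFact a ⊛ qFact b)
        ≈⟨ ⊛-congʳ (qFact a ⊛ qFact b) (⊛-congʳ (qFact m′) (topHookGF-< a<k)) ⟩
      (largePartsGF b (a + m) ⊛ qFact m′) ⊛ (qFact a ⊛ qFact b)
        ≈⟨ largePartsGF-qBinomial a b ⟩
      shift (b * m) (qFact (a + b))
        ≡⟨ cong (λ j → shift (b * m) (qFact j)) (ℕ.suc-injective 1+a+b≡k) ⟩
      shift (b * m) (qFact k′)
        ∎)
    exponent : E ≡ m + a + b * m
    exponent = trans (cong (λ j → j * m ∸ a * m′) (sym 1+a+b≡k)) (rhsTerm-exponent a b)

  rhsSum : Series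
  rhsSum = sumSeries (map (rhsTerm m k) (map suc (upTo k)))

  hooksGF-qFact : ∀ n → hooksGF (m′ + (n + k)) ⊛ qFact (m′ + (n + k)) ≗ rhsSum ⊛ qFact k′
  hooksGF-qFact n = begin
    hooksGF (m′ + t) ⊛ qFact (m′ + t)               ≈⟨ ⊛-congˡ (hooksGF (m′ + t)) (pochFin-+ 1 m′ t) ⟩
    hooksGF (m′ + t) ⊛ (qFact m′ ⊛ pochFin m t)     ≈⟨ x∙yz≈xz∙y (hooksGF (m′ + t)) (qFact m′) (pochFin m t) ⟩
    (hooksGF (m′ + t) ⊛ pochFin m t) ⊛ qFact m′     ≈⟨ ⊛-congʳ (qFact m′) (hooksGF-telescope t) ⟩
    ∑ˢ t term ⊛ qFact m′                            ≈⟨ ∑ˢ-⊛ t term (qFact m′) ⟩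
    ∑ˢ (n + k) (λ a → term a ⊛ qFact m′)            ≈⟨ ∑ˢ-extend k n (λ a → term a ⊛ qFact m′) (λ k≤a →
                                                       ≗-trans (⊛-congʳ (qFact m′) (term-≥ k≤a)) (⊛-zeroˡ (qFact m′))) ⟩
    ∑ˢ k (λ a → term a ⊛ qFact m′)                  ≈⟨ ∑ˢ-cong k term-< ⟩
    ∑ˢ k (λ a → rhsTerm m k (suc a) ⊛ qFact k′)     ≈⟨ ∑ˢ-⊛ k (rhsTerm m k ∘ suc) (qFact k′) ⟨
    ∑ˢ k (rhsTerm m k ∘ suc) ⊛ qFact k′             ≈⟨ ⊛-congʳ (qFact k′) rhsSum-∑ˢ ⟨
    rhsSum ⊛ qFact k′                               ∎
    where
    open ≗-Reasoning
    t : ℕ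
    t = n + k
    rhsSum-∑ˢ : rhsSum ≗ ∑ˢ k (rhsTerm m k ∘ suc)
    rhsSum-∑ˢ = ≗-trans (cong-app (cong sumSeries (sym (List.map-∘ {g = rhsTerm m k} {f = suc} (upTo k)))))
                        (sumSeries-upTo k (rhsTerm m k ∘ suc))

  hooksGF-closedForm : ∀ n → hooksGF (m′ + (n + k)) ≗ inv (pochFin k (suc (m′ + n))) ⊛ rhsSum
  hooksGF-closedForm n = ⊛-cancelʳ (qFact N) (qFact-constant N) (begin
    hooksGF N ⊛ qFact N                       ≈⟨ hooksGF-qFact n ⟩
    rhsSum ⊛ qFact k′                         ≈⟨ ⊛-identityʳ (rhsSum ⊛ qFact k′) ⟨
    (rhsSum ⊛ qFact k′) ⊛ one                 ≈⟨ ⊛-congˡ (rhsSum ⊛ qFact k′)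
                                                   (⊛-inverseˡ (pochFin k J) (pochFin-constant k′ J)) ⟨
    (rhsSum ⊛ qFact k′) ⊛ (inv (pochFin k J) ⊛ pochFin k J)
                                              ≈⟨ ⊛-interchange rhsSum (qFact k′) (inv (pochFin k J)) (pochFin k J) ⟩
    (rhsSum ⊛ inv (pochFin k J)) ⊛ (qFact k′ ⊛ pochFin k J)
                                              ≈⟨ ⊛-cong (⊛-comm (inv (pochFin k J)) rhsSum) (pochFin-+ 1 k′ J) ⟨
    (inv (pochFin k J) ⊛ rhsSum) ⊛ qFact (k′ + J)
                                              ≡⟨ cong (λ i → (inv (pochFin k J) ⊛ rhsSum) ⊛ qFact i) N≡k′+J ⟨
    (inv (pochFin k J) ⊛ rhsSum) ⊛ qFact N    ∎)
    where
    open ≗-Reasoning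
    N J : ℕ
    N = m′ + (n + k)
    J = suc (m′ + n)
    N≡k′+J : N ≡ k′ + J
    N≡k′+J = reorder m′ n k′
      where
      reorder : ∀ m′ n k′ → m′ + (n + (1 + k′)) ≡ k′ + (1 + (m′ + n))
      reorder = solve-∀

open import Data.Nat using (_+_; _<_; s≤s)
import Data.Nat.Properties as ℕ

theorem1p5 : (m k : ℕ) → 1 ≤ m → 1 ≤ k → (n : ℕ) → (L : List (List ℕ))
    → Unique L → ((p : List ℕ) → (p ∈ L → IsPartitionOf n p) × (IsPartitionOf n p → p ∈ L))
    → + (sum (map (colHooks m k) L)) ≡ rhs m k n
theorem1p5 (suc m′) (suc k′) _ _ n L unique-L L-spec = begin
  + sum (map (colHooks m k) L)             ≡⟨ cong +_ (sum-over-partitions (colHooks m k) n≤N L unique-L L-spec) ⟩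
  hooksGF N n                              ≡⟨ hooksGF-closedForm n n ⟩
  (inv (pochFin k J) ⊛ rhsSum) n                ≡⟨ ⊛-coeff-congʳ rhsSum n
                                                     (inv-cong-≤ n λ i≤n → sym (pochInf-≗[≤] k n<J i≤n)) ⟩
  rhs m k n                                     ∎
  where
  open ≡-Reasoning
  open LargeParts m′ using (m)
  open HookSeries m′ k′
  N J : ℕ
  N = m′ + (n + k)
  J = suc (m′ + n)
  n≤N : n ≤ N
  n≤N = ℕ.≤-trans (ℕ.m≤m+n n k) (ℕ.m≤n+m (n + k) m′)
  n<J : n < J
  n<J = s≤s (ℕ.m≤n+m n m′)
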